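{- Let $F(x_1,\ldots,x_n)\in\mathbb{Q}_2[x_1,\ldots,x_n]$ be a quartic form whose only zero in $\mathbb{Q}_2^n$ is the trivial one, and let $S=\{\mathbf{e}_1,\ldots,\mathbf{e}_k\}$ be a set of $k$ non-zero vectors in $\mathbb{Q}_2^n$. If \[n>V_3\Big(k,\tfrac{k(k+1)}{2},\tfrac{k(k+1)(k+2)}{6};2\Big),\] then there is a vector $\mathbf{e}$ orthogonal to $S$.
   Context: A non-zero vector $\mathbf{e}\in\mathbb{Q}_2^n$ is orthogonal to $S=\{\mathbf{e}_1,\ldots,\mathbf{e}_k\}$ (with respect to $F$) if $F(x_1\mathbf{e}_1+\cdots+x_k\mathbf{e}_k+x\mathbf{e})=F(x_1\mathbf{e}_1+\cdots+x_k\mathbf{e}_k)+F(\mathbf{e})x^4$ identically in $x_1,\ldots,x_k,x$. For non-negative integers $a,b,c$, $V_3(a,b,c;2)$ denotes the largest integer $n$ for which there exists a system of $a$ cubic forms, $b$ quadratic forms and $c$ linear forms over $\mathbb{Q}_2$ in $n$ variables whose only common zero in $\mathbb{Q}_2^n$ is the trivial one. -}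

module Defs where

open import Data.Nat as ℕ using (ℕ; zero; suc; _<_; _≤_; _^_; _∸_)
open import Data.Nat.DivMod using (_/_; _%_)
open import Data.Bool using (Bool; true; false; if_then_else_)
open import Data.Fin as Fin using (Fin)
open import Data.Product using (Σ; _×_; _,_)
open import Relation.Binary.PropositionalEquality using (_≡_)
open import Relation.Nullary using (¬_; does)

-- The 2-adic integers ℤ₂, as streams of binary digits
-- (a i = the coefficient of 2^i).  Every stream is a 2-adic integer
-- and conversely, so this is exactly ℤ₂.

ℤ₂ : Set
ℤ₂ = ℕ → Bool

bitVal : Bool → ℕ
bitVal true  = 1
bitVal false = 0

res : ℤ₂ → ℕ → ℕ
res a zero    = 0
res a (suc k) = res a k ℕ.+ bitVal (a k) ℕ.* (2 ^ k)

bit : ℕ → ℕ → Bool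
bit x zero    = does ((x % 2) ℕ.≟ 1)
bit x (suc i) = bit (x / 2) i

-- ring operations: the i-th digit depends only on residues mod 2^(i+1)
_+ᶻ_ : ℤ₂ → ℤ₂ → ℤ₂
(a +ᶻ b) i = bit (res a (suc i) ℕ.+ res b (suc i)) i

_*ᶻ_ : ℤ₂ → ℤ₂ → ℤ₂
(a *ᶻ b) i = bit (res a (suc i) ℕ.* res b (suc i)) i

-ᶻ_ : ℤ₂ → ℤ₂
(-ᶻ a) i = bit (2 ^ suc i ∸ res a (suc i)) i

0ᶻ : ℤ₂
0ᶻ _ = false

shift : ℕ → ℤ₂ → ℤ₂
shift j a i = if does (i ℕ.<? j) then false else a (i ∸ j)

_≈ᶻ_ : ℤ₂ → ℤ₂ → Set
a ≈ᶻ b = ∀ i → a i ≡ b i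

-- The 2-adic numbers ℚ₂ = ℤ₂[1/2]: a pair (m , a) denotes a / 2^m.

record ℚ₂ : Set where
  constructor _/2^_
  field
    num : ℤ₂
    den : ℕ
open ℚ₂ public

infix  4 _≈_
infixl 6 _+_
infixl 7 _*_

-- a/2^m = b/2^m'  iff  2^m' a = 2^m b  (ℤ₂ is an integral domain)
_≈_ : ℚ₂ → ℚ₂ → Set
(a /2^ m) ≈ (b /2^ m') = shift m' a ≈ᶻ shift m b

_+_ : ℚ₂ → ℚ₂ → ℚ₂
(a /2^ m) + (b /2^ m') = (shift m' a +ᶻ shift m b) /2^ (m ℕ.+ m')

_*_ : ℚ₂ → ℚ₂ → ℚ₂
(a /2^ m) * (b /2^ m') = (a *ᶻ b) /2^ (m ℕ.+ m')

-_ : ℚ₂ → ℚ₂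
- (a /2^ m) = (-ᶻ a) /2^ m

0q : ℚ₂
0q = 0ᶻ /2^ 0

Vec₂ : ℕ → Set
Vec₂ n = Fin n → ℚ₂

∑ : (n : ℕ) → (Fin n → ℚ₂) → ℚ₂
∑ zero    f = 0q
∑ (suc n) f = f Fin.zero + ∑ n (λ i → f (Fin.suc i))

IsZeroVec : {n : ℕ} → Vec₂ n → Set
IsZeroVec v = ∀ i → v i ≈ 0q

NonZeroVec : {n : ℕ} → Vec₂ n → Set
NonZeroVec v = ¬ IsZeroVec v

_+ᵛ_ : {n : ℕ} → Vec₂ n → Vec₂ n → Vec₂ n
(u +ᵛ v) i = u i + v i

_·ᵛ_ : {n : ℕ} → ℚ₂ → Vec₂ n → Vec₂ n
(c ·ᵛ v) i = c * v i

lincomb : {n k : ℕ} → (Fin k → Vec₂ n) → (Fin k → ℚ₂) → Vec₂ n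
lincomb {n} {k} e x i = ∑ k (λ j → x j * e j i)

-- Forms over ℚ₂ in n variables, given by (not necessarily symmetric)
-- coefficient arrays; every homogeneous polynomial of the given degree
-- arises this way.

LinearForm : ℕ → Set
LinearForm n = Fin n → ℚ₂

QuadraticForm : ℕ → Set
QuadraticForm n = Fin n → Fin n → ℚ₂

CubicForm : ℕ → Set
CubicForm n = Fin n → Fin n → Fin n → ℚ₂

QuarticForm : ℕ → Set
QuarticForm n = Fin n → Fin n → Fin n → Fin n → ℚ₂

evalL : {n : ℕ} → LinearForm n → Vec₂ n → ℚ₂
evalL {n} c x = ∑ n (λ i → c i * x i)

evalQ : {n : ℕ} → QuadraticForm n → Vec₂ n → ℚ₂
evalQ {n} c x = ∑ n (λ i → ∑ n (λ j → c i j * x i * x j))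

evalC : {n : ℕ} → CubicForm n → Vec₂ n → ℚ₂
evalC {n} c x = ∑ n (λ i → ∑ n (λ j → ∑ n (λ l → c i j l * x i * x j * x l)))

evalF : {n : ℕ} → QuarticForm n → Vec₂ n → ℚ₂
evalF {n} c x =
  ∑ n (λ i → ∑ n (λ j → ∑ n (λ l → ∑ n (λ m → c i j l m * x i * x j * x l * x m))))

OnlyTrivialZero : {n : ℕ} → QuarticForm n → Set
OnlyTrivialZero {n} F = (x : Vec₂ n) → evalF F x ≈ 0q → IsZeroVec x

_^4 : ℚ₂ → ℚ₂
t ^4 = t * t * t * t

Orthogonal : {n k : ℕ} → QuarticForm n → (Fin k → Vec₂ n) → Vec₂ n → Set
Orthogonal {n} {k} F S e =
  NonZeroVec e ×
  ((x : Fin k → ℚ₂) (t : ℚ₂) →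
     evalF F (lincomb S x +ᵛ (t ·ᵛ e)) ≈ evalF F (lincomb S x) + evalF F e * (t ^4))

record System (a b c n : ℕ) : Set where
  field
    cubics     : Fin a → CubicForm n
    quadratics : Fin b → QuadraticForm n
    linears    : Fin c → LinearForm n

CommonZero : {a b c n : ℕ} → System a b c n → Vec₂ n → Set
CommonZero {a} {b} {c} s x =
  (∀ (i : Fin a) → evalC (System.cubics s i) x ≈ 0q) ×
  (∀ (i : Fin b) → evalQ (System.quadratics s i) x ≈ 0q) ×
  (∀ (i : Fin c) → evalL (System.linears s i) x ≈ 0q)

OnlyTrivialCommonZero : {a b c n : ℕ} → System a b c n → Set
OnlyTrivialCommonZero {n = n} s = (x : Vec₂ n) → CommonZero s x → IsZeroVec x

IsV₃ : ℕ → ℕ → ℕ → ℕ → Set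
IsV₃ a b c v =
  Σ (System a b c v) OnlyTrivialCommonZero ×
  (∀ (m : ℕ) → Σ (System a b c m) OnlyTrivialCommonZero → m ≤ v)

module Submission where

-- Write u = x₁e₁ + ⋯ + x_k e_k. The coefficient of t^r (r = 1, 2, 3) in F(u + t e) is a form of
-- degree 4 - r in x and r in e; asking that each of its coefficients, one per monomial in x,
-- vanish gives k cubic, k(k+1)/2 quadratic and k(k+1)(k+2)/6 linear forms in e, and every
-- nonzero common zero e of these forms is orthogonal to S. As n exceeds V₃ of these numbers,
-- the system cannot have only the trivial zero. The argument is by contradiction, whence the
-- double negation; equality in ℚ₂ is stable under ¬¬, which turns "e is not orthogonal" into
-- "e = 0".
--
-- The expansion holds over any commutative ring. ℚ₂ is one: its equations reduce to
-- congruences of numerator residues modulo 2^k.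

open import Algebra.Bundles using (CommutativeRing)
open import Level using (0ℓ)

module Residues where

  open import Defs using (ℤ₂; bitVal; res; bit; _+ᶻ_; _*ᶻ_; -ᶻ_; 0ᶻ; shift; _≈ᶻ_)
  open import Data.Bool using (true; false)
  open import Data.Nat using (ℕ; zero; suc; _+_; _*_; _^_; _∸_; _≤_; _<_; _<?_; z≤n; s≤s; NonZero)
  open import Data.Nat.Properties
  open import Data.Nat.DivMod
  open import Data.Nat.Divisibility using (_∣_; divides)
  open import Data.Nat.Tactic.RingSolver using (solve-∀)
  open import Data.Sum using (inj₁; inj₂)
  open import Relation.Binary.Bundles using (Setoid)
  import Relation.Binary.Reasoning.Setoid as SetoidReasoning
  open import Relation.Binary.PropositionalEquality
  open import Relation.Nullary.Decidable using (dec-true; dec-false)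

  -- Instance search cannot find NonZero (2 ^ k) for a variable k, as _^_ is not injective;
  -- hence this wrapper and the local instances below.
  _%2^_ : ℕ → ℕ → ℕ
  x %2^ k = _%_ x (2 ^ k) {{m^n≢0 2 k}}

  -- A record, so that k can be recovered from a proof.
  infix 4 _≡_[mod2^_]
  record _≡_[mod2^_] (x y k : ℕ) : Set where
    constructor ≡mod
    field %≡% : x %2^ k ≡ y %2^ k
  open _≡_[mod2^_] public

  mod2^-setoid : ℕ → Setoid 0ℓ 0ℓ
  mod2^-setoid k = record
    { Carrier = ℕ
    ; _≈_ = λ x y → x ≡ y [mod2^ k ]
    ; isEquivalence = record
      { refl = ≡mod refl ; sym = λ (≡mod p) → ≡mod (sym p) ; trans = λ (≡mod p) (≡mod q) → ≡mod (trans p q) } }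

  module mod2^-Reasoning (k : ℕ) = SetoidReasoning (mod2^-setoid k)

  module _ {k : ℕ} where
    open Setoid (mod2^-setoid k) public
      using () renaming (refl to mod-refl; sym to mod-sym; trans to mod-trans; reflexive to ≡⇒≡mod)

    private instance
      2^k≢0 : NonZero (2 ^ k)
      2^k≢0 = m^n≢0 2 k

    %≡mod : ∀ x → x % 2 ^ k ≡ x [mod2^ k ]
    %≡mod x = ≡mod (m%n%n≡m%n x (2 ^ k))

    +-cong-mod : ∀ {x y x' y'} → x ≡ x' [mod2^ k ] → y ≡ y' [mod2^ k ] → x + y ≡ x' + y' [mod2^ k ]
    +-cong-mod {x} {y} {x'} {y'} (≡mod p) (≡mod q) = ≡mod (begin
        (x + y) % 2 ^ k                    ≡⟨ %-distribˡ-+ x y (2 ^ k) ⟩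
        (x % 2 ^ k + y % 2 ^ k) % 2 ^ k    ≡⟨ cong₂ (λ u v → (u + v) % 2 ^ k) p q ⟩
        (x' % 2 ^ k + y' % 2 ^ k) % 2 ^ k  ≡⟨ %-distribˡ-+ x' y' (2 ^ k) ⟨
        (x' + y') % 2 ^ k                  ∎)
      where open ≡-Reasoning

    *-cong-mod : ∀ {x y x' y'} → x ≡ x' [mod2^ k ] → y ≡ y' [mod2^ k ] → x * y ≡ x' * y' [mod2^ k ]
    *-cong-mod {x} {y} {x'} {y'} (≡mod p) (≡mod q) = ≡mod (begin
        (x * y) % 2 ^ k                      ≡⟨ %-distribˡ-* x y (2 ^ k) ⟩
        (x % 2 ^ k * (y % 2 ^ k)) % 2 ^ k    ≡⟨ cong₂ (λ u v → (u * v) % 2 ^ k) p q ⟩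
        (x' % 2 ^ k * (y' % 2 ^ k)) % 2 ^ k  ≡⟨ %-distribˡ-* x' y' (2 ^ k) ⟨
        (x' * y') % 2 ^ k                    ∎)
      where open ≡-Reasoning

    *-congˡ-mod : ∀ c {y y'} → y ≡ y' [mod2^ k ] → c * y ≡ c * y' [mod2^ k ]
    *-congˡ-mod c = *-cong-mod (mod-refl {x = c})

    2^k≡0 : 2 ^ k ≡ 0 [mod2^ k ]
    2^k≡0 = ≡mod (trans (n%n≡0 (2 ^ k)) (sym (m<n⇒m%n≡m (m^n>0 2 k))))

    ∸+≡0 : ∀ {r} → r ≤ 2 ^ k → (2 ^ k ∸ r) + r ≡ 0 [mod2^ k ]
    ∸+≡0 r≤2^k = mod-trans (≡⇒≡mod (m∸n+n≡m r≤2^k)) 2^k≡0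

    -- Adding 2^k ∸ (r mod 2^k) undoes the addition of r.
    +-cancelʳ-mod : ∀ {x y r r'} → x + r ≡ y + r' [mod2^ k ] → r ≡ r' [mod2^ k ] → x ≡ y [mod2^ k ]
    +-cancelʳ-mod {x} {y} {r} {r'} p q = begin
        x                              ≈⟨ add-inverse x r ⟨
        x + r + (2 ^ k ∸ r % 2 ^ k)    ≈⟨ +-cong-mod p (≡⇒≡mod (cong (2 ^ k ∸_) (%≡% q))) ⟩
        y + r' + (2 ^ k ∸ r' % 2 ^ k)  ≈⟨ add-inverse y r' ⟩
        y                              ∎
      where
      open mod2^-Reasoning k
      add-inverse : ∀ x r → x + r + (2 ^ k ∸ r % 2 ^ k) ≡ x [mod2^ k ]
      add-inverse x r = begin
          x + r + (2 ^ k ∸ r % 2 ^ k)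
            ≡⟨ cong (λ z → x + z + (2 ^ k ∸ r % 2 ^ k)) (m≡m%n+[m/n]*n r (2 ^ k)) ⟩
          x + (r % 2 ^ k + r / 2 ^ k * 2 ^ k) + (2 ^ k ∸ r % 2 ^ k)
            ≡⟨ regroup x (r % 2 ^ k) (r / 2 ^ k * 2 ^ k) _ ⟩
          x + r / 2 ^ k * 2 ^ k + ((2 ^ k ∸ r % 2 ^ k) + r % 2 ^ k)
            ≈⟨ +-cong-mod (≡mod ([m+kn]%n≡m%n x (r / 2 ^ k) (2 ^ k))) (∸+≡0 (m%n≤n r (2 ^ k))) ⟩
          x + 0
            ≡⟨ +-identityʳ x ⟩
          x ∎
        where regroup : ∀ a b c d → a + (b + c) + d ≡ a + c + (d + b)
              regroup = solve-∀

    ≡mod⇒≡ : ∀ {x y} → x < 2 ^ k → y < 2 ^ k → x ≡ y [mod2^ k ] → x ≡ y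
    ≡mod⇒≡ x< y< (≡mod p) = trans (sym (m<n⇒m%n≡m x<)) (trans p (m<n⇒m%n≡m y<))

  ≡%2^⇒≡mod : ∀ {k x y} → x ≡ y %2^ k → x ≡ y [mod2^ k ]
  ≡%2^⇒≡mod {k} {y = y} x≡ = mod-trans (≡⇒≡mod x≡) (%≡mod y)

  mod-weaken : ∀ {j k x y} → j ≤ k → x ≡ y [mod2^ k ] → x ≡ y [mod2^ j ]
  mod-weaken {j} {k} {x} {y} j≤k (≡mod p) = ≡mod (begin
      x % 2 ^ j          ≡⟨ m∣n⇒o%n%m≡o%m (2 ^ j) (2 ^ k) x 2^j∣2^k ⟨
      x % 2 ^ k % 2 ^ j  ≡⟨ cong (_% 2 ^ j) p ⟩
      y % 2 ^ k % 2 ^ j  ≡⟨ m∣n⇒o%n%m≡o%m (2 ^ j) (2 ^ k) y 2^j∣2^k ⟩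
      y % 2 ^ j          ∎)
    where
    open ≡-Reasoning
    instance _ = m^n≢0 2 j ; _ = m^n≢0 2 k
    2^j∣2^k : 2 ^ j ∣ 2 ^ k
    2^j∣2^k = divides (2 ^ (k ∸ j)) (trans (cong (2 ^_) (sym (m∸n+n≡m j≤k))) (^-distribˡ-+-* 2 (k ∸ j) j))

  2^j*x≡0 : ∀ {j k} x → k ≤ j → 2 ^ j * x ≡ 0 [mod2^ k ]
  2^j*x≡0 {j} x k≤j = mod-weaken k≤j (≡mod (begin
      (2 ^ j * x) % 2 ^ j  ≡⟨ cong (_% 2 ^ j) (*-comm (2 ^ j) x) ⟩
      (x * 2 ^ j) % 2 ^ j  ≡⟨ m*n%n≡0 x (2 ^ j) ⟩
      0                    ≡⟨ m<n⇒m%n≡m (m^n>0 2 j) ⟨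
      0 % 2 ^ j            ∎))
    where open ≡-Reasoning
          instance _ = m^n≢0 2 j

  2^j*-cong-mod : ∀ j {m x y} → x ≡ y [mod2^ m ] → 2 ^ j * x ≡ 2 ^ j * y [mod2^ (j + m) ]
  2^j*-cong-mod j {m} {x} {y} (≡mod p) = ≡mod (begin
      (2 ^ j * x) % 2 ^ (j + m)  ≡⟨ shifted x ⟨
      x % 2 ^ m * 2 ^ j          ≡⟨ cong (_* 2 ^ j) p ⟩
      y % 2 ^ m * 2 ^ j          ≡⟨ shifted y ⟩
      (2 ^ j * y) % 2 ^ (j + m)  ∎)
    where
    open ≡-Reasoning
    instance _ = m^n≢0 2 m ; _ = m^n≢0 2 (j + m) ; _ = m*n≢0 (2 ^ m) (2 ^ j) {{m^n≢0 2 m}} {{m^n≢0 2 j}}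
    2^m*2^j≡2^[j+m] : 2 ^ m * 2 ^ j ≡ 2 ^ (j + m)
    2^m*2^j≡2^[j+m] = trans (*-comm (2 ^ m) (2 ^ j)) (sym (^-distribˡ-+-* 2 j m))
    shifted : ∀ z → z % 2 ^ m * 2 ^ j ≡ (2 ^ j * z) % 2 ^ (j + m)
    shifted z = trans (m%n*o≡m*o%[n*o] z (2 ^ m) (2 ^ j))
                      (trans (%-congʳ 2^m*2^j≡2^[j+m]) (cong (_% 2 ^ (j + m)) (*-comm z (2 ^ j))))

  bitVal≤1 : ∀ b → bitVal b ≤ 1
  bitVal≤1 true  = s≤s z≤n
  bitVal≤1 false = z≤n

  bitVal-injective : ∀ {b c} → bitVal b ≡ bitVal c → b ≡ c
  bitVal-injective {true}  {true}  _ = refl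
  bitVal-injective {false} {false} _ = refl

  %2≡bit0 : ∀ y → y % 2 ≡ bitVal (bit y 0)
  %2≡bit0 y with y % 2 | m%n<n y 2
  ... | 0           | _ = refl
  ... | 1           | _ = refl
  ... | suc (suc r) | s≤s (s≤s ())

  m%[n*2]≡m%2+[m/2%n]*2 : ∀ y M .{{_ : NonZero M}} {{_ : NonZero (M * 2)}} → y % (M * 2) ≡ y % 2 + (y / 2) % M * 2
  m%[n*2]≡m%2+[m/2%n]*2 y M = begin
      y % (M * 2)                                 ≡⟨ m≡m%n+[m/n]*n (y % (M * 2)) 2 ⟩
      y % (M * 2) % 2 + (y % (M * 2) / 2) * 2     ≡⟨ cong₂ (λ u v → u + v * 2) (m∣n⇒o%n%m≡o%m 2 (M * 2) y (divides M refl))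
                                                                             (m%[n*o]/o≡m/o%n y M 2) ⟩
      y % 2 + (y / 2) % M * 2                     ∎
    where open ≡-Reasoning

  %2^-suc : ∀ y k → y %2^ suc k ≡ y %2^ k + bitVal (bit y k) * 2 ^ k
  %2^-suc y zero = trans (%2≡bit0 y) (sym (trans (cong (_+ bitVal (bit y 0) * 1) (n%1≡0 y)) (*-identityʳ _)))
  %2^-suc y (suc k) = begin
      y %2^ suc (suc k)                                    ≡⟨ %-congʳ (*-comm 2 (2 ^ suc k)) ⟩
      y % (2 ^ suc k * 2)                                  ≡⟨ m%[n*2]≡m%2+[m/2%n]*2 y (2 ^ suc k) ⟩
      y % 2 + (y / 2) %2^ suc k * 2                        ≡⟨ cong (λ z → y % 2 + z * 2) (%2^-suc (y / 2) k) ⟩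
      y % 2 + ((y / 2) %2^ k + b * 2 ^ k) * 2              ≡⟨ regroup (y % 2) ((y / 2) %2^ k) b (2 ^ k) ⟩
      (y % 2 + (y / 2) %2^ k * 2) + b * (2 ^ k * 2)        ≡⟨ cong₂ (λ u v → u + b * v) (m%[n*2]≡m%2+[m/2%n]*2 y (2 ^ k))
                                                                                        (*-comm 2 (2 ^ k)) ⟨
      y % (2 ^ k * 2) + b * 2 ^ suc k                      ≡⟨ cong (_+ b * 2 ^ suc k) (%-congʳ (*-comm (2 ^ k) 2)) ⟩
      y %2^ suc k + b * 2 ^ suc k                          ∎
    where
    open ≡-Reasoning
    b : ℕ
    b = bitVal (bit (y / 2) k)
    regroup : ∀ p q r s → p + (q + r * s) * 2 ≡ (p + q * 2) + r * (s * 2)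
    regroup = solve-∀
    instance
      _ = m^n≢0 2 k ; _ = m^n≢0 2 (suc k) ; _ = m^n≢0 2 (suc (suc k))
      _ = m*n≢0 (2 ^ suc k) 2 {{m^n≢0 2 (suc k)}} ; _ = m*n≢0 (2 ^ k) 2 {{m^n≢0 2 k}}

  res<2^k : ∀ a k → res a k < 2 ^ k
  res<2^k a zero    = s≤s z≤n
  res<2^k a (suc k) = begin-strict
      res a k + bitVal (a k) * 2 ^ k  <⟨ +-monoˡ-< (bitVal (a k) * 2 ^ k) (res<2^k a k) ⟩
      2 ^ k + bitVal (a k) * 2 ^ k    ≤⟨ +-monoʳ-≤ (2 ^ k) (*-monoˡ-≤ (2 ^ k) (bitVal≤1 (a k))) ⟩
      2 ^ k + 1 * 2 ^ k               ≡⟨ cong (λ z → 2 ^ k + z) (trans (*-identityˡ (2 ^ k)) (sym (+-identityʳ (2 ^ k)))) ⟩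
      2 ^ suc k                       ∎
    where open ≤-Reasoning

  res-suc : ∀ a k → res a (suc k) ≡ res a k [mod2^ k ]
  res-suc a k = ≡mod ([m+kn]%n≡m%n (res a k) (bitVal (a k)) (2 ^ k))
    where instance _ = m^n≢0 2 k

  res-mono : ∀ a {j k} → j ≤ k → res a k ≡ res a j [mod2^ j ]
  res-mono a {j} {zero}  z≤n = mod-refl
  res-mono a {j} {suc k} j≤1+k with m≤n⇒m<n∨m≡n j≤1+k
  ... | inj₂ refl = mod-refl
  ... | inj₁ j<1+k = mod-trans (mod-weaken (≤-pred j<1+k) (res-suc a k)) (res-mono a (≤-pred j<1+k))

  res-injective : ∀ {a b} → (∀ k → res a k ≡ res b k) → a ≈ᶻ b
  res-injective {a} {b} eq i = bitVal-injective (*-cancelʳ-≡ _ _ (2 ^ i) {{m^n≢0 2 i}}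
    (+-cancelˡ-≡ (res a i) _ _ (trans (eq (suc i)) (cong (_+ bitVal (b i) * 2 ^ i) (sym (eq i))))))

  res-cong : ∀ {a b} → a ≈ᶻ b → ∀ k → res a k ≡ res b k
  res-cong a≈b zero    = refl
  res-cong a≈b (suc k) = cong₂ (λ r d → r + bitVal d * 2 ^ k) (res-cong a≈b k) (a≈b k)

  ≈ᶻ-intro : ∀ {a b} → (∀ k → res a k ≡ res b k [mod2^ k ]) → a ≈ᶻ b
  ≈ᶻ-intro {a} {b} eq = res-injective (λ k → ≡mod⇒≡ (res<2^k a k) (res<2^k b k) (eq k))

  ≈ᶻ-elim : ∀ {a b} → a ≈ᶻ b → ∀ k → res a k ≡ res b k [mod2^ k ]
  ≈ᶻ-elim a≈b k = ≡⇒≡mod (res-cong a≈b k)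

  -- Every operation of Defs has this shape: the i-th digit of the result is the i-th
  -- digit of a residue computed modulo 2^(i+1).
  digits : (ℕ → ℕ) → ℤ₂
  digits R i = bit (R (suc i)) i

  res-digits : ∀ R → (∀ k → R (suc k) ≡ R k [mod2^ k ]) → ∀ k → res (digits R) k ≡ R k [mod2^ k ]
  res-digits R coherent k = ≡%2^⇒≡mod (exact k)
    where
    exact : ∀ k → res (digits R) k ≡ R k %2^ k
    exact zero    = sym (n%1≡0 (R 0))
    exact (suc k) = begin
        res (digits R) k + bitVal (bit (R (suc k)) k) * 2 ^ k
          ≡⟨ cong (_+ bitVal (bit (R (suc k)) k) * 2 ^ k) (trans (exact k) (sym (%≡% (coherent k)))) ⟩
        R (suc k) %2^ k + bitVal (bit (R (suc k)) k) * 2 ^ k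
          ≡⟨ %2^-suc (R (suc k)) k ⟨
        R (suc k) %2^ suc k
          ∎
      where open ≡-Reasoning

  res-+ᶻ : ∀ a b k → res (a +ᶻ b) k ≡ res a k + res b k [mod2^ k ]
  res-+ᶻ a b = res-digits (λ j → res a j + res b j) (λ k → +-cong-mod (res-suc a k) (res-suc b k))

  res-*ᶻ : ∀ a b k → res (a *ᶻ b) k ≡ res a k * res b k [mod2^ k ]
  res-*ᶻ a b = res-digits (λ j → res a j * res b j) (λ k → *-cong-mod (res-suc a k) (res-suc b k))

  res-∸+ : ∀ a k → 2 ^ k ∸ res a k + res a k ≡ 0 [mod2^ k ]
  res-∸+ a k = ∸+≡0 (<⇒≤ (res<2^k a k))

  res--ᶻ : ∀ a k → res (-ᶻ a) k ≡ 2 ^ k ∸ res a k [mod2^ k ]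
  res--ᶻ a = res-digits (λ j → 2 ^ j ∸ res a j) coherent
    where
    coherent : ∀ k → 2 ^ suc k ∸ res a (suc k) ≡ 2 ^ k ∸ res a k [mod2^ k ]
    coherent k = +-cancelʳ-mod (begin
        2 ^ suc k ∸ res a (suc k) + res a (suc k)  ≡⟨ m∸n+n≡m (<⇒≤ (res<2^k a (suc k))) ⟩
        2 ^ k + (2 ^ k + 0)                        ≈⟨ +-cong-mod 2^k≡0 (≡⇒≡mod (+-identityʳ (2 ^ k))) ⟩
        0 + 2 ^ k                                  ≈⟨ 2^k≡0 ⟩
        0                                          ≈⟨ res-∸+ a k ⟨
        2 ^ k ∸ res a k + res a k                  ∎) (res-suc a k)
      where open mod2^-Reasoning k

  res-bit : ∀ x k → res (bit x) k ≡ x [mod2^ k ]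
  res-bit x = res-digits (λ _ → x) (λ _ → mod-refl)

  res-0ᶻ : ∀ k → res 0ᶻ k ≡ 0
  res-0ᶻ zero    = refl
  res-0ᶻ (suc k) = trans (+-identityʳ _) (res-0ᶻ k)

  shift-low : ∀ j a i → i < j → shift j a i ≡ false
  shift-low j a i i<j rewrite dec-true (i <? j) i<j = refl

  shift-high : ∀ j a m → shift j a (j + m) ≡ a m
  shift-high j a m rewrite dec-false ((j + m) <? j) (m+n≮m j m) | m+n∸m≡n j m = refl

  res-shift-low : ∀ j a k → k ≤ j → res (shift j a) k ≡ 0
  res-shift-low j a zero    _    = refl
  res-shift-low j a (suc k) k<j rewrite res-shift-low j a k (<⇒≤ k<j) | shift-low j a k k<j = refl

  res-shift-high : ∀ j a m → res (shift j a) (j + m) ≡ 2 ^ j * res a m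
  res-shift-high j a zero = trans (cong (res (shift j a)) (+-identityʳ j))
                                  (trans (res-shift-low j a j ≤-refl) (sym (*-zeroʳ (2 ^ j))))
  res-shift-high j a (suc m) = begin
      res (shift j a) (j + suc m)
        ≡⟨ cong (res (shift j a)) (+-suc j m) ⟩
      res (shift j a) (j + m) + bitVal (shift j a (j + m)) * 2 ^ (j + m)
        ≡⟨ cong₂ (λ u v → u + bitVal v * 2 ^ (j + m)) (res-shift-high j a m) (shift-high j a m) ⟩
      2 ^ j * res a m + bitVal (a m) * 2 ^ (j + m)
        ≡⟨ cong (λ z → 2 ^ j * res a m + bitVal (a m) * z) (^-distribˡ-+-* 2 j m) ⟩
      2 ^ j * res a m + bitVal (a m) * (2 ^ j * 2 ^ m)
        ≡⟨ factor (2 ^ j) (res a m) (bitVal (a m)) (2 ^ m) ⟩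
      2 ^ j * (res a m + bitVal (a m) * 2 ^ m)
        ∎
    where
    open ≡-Reasoning
    factor : ∀ p q r s → p * q + r * (p * s) ≡ p * (q + r * s)
    factor = solve-∀

  res-shift : ∀ j a k → res (shift j a) k ≡ 2 ^ j * res a k [mod2^ k ]
  res-shift j a k with ≤-total k j
  ... | inj₁ k≤j = mod-trans (≡⇒≡mod (res-shift-low j a k k≤j)) (mod-sym (2^j*x≡0 (res a k) k≤j))
  ... | inj₂ j≤k = subst (λ k → res (shift j a) k ≡ 2 ^ j * res a k [mod2^ k ]) (m+[n∸m]≡n j≤k) (begin
      res (shift j a) (j + m)  ≡⟨ res-shift-high j a m ⟩
      2 ^ j * res a m          ≈⟨ 2^j*-cong-mod j (res-mono a (m≤n+m m j)) ⟨
      2 ^ j * res a (j + m)    ∎)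
    where
    m : ℕ
    m = k ∸ j
    open mod2^-Reasoning (j + m)

  shift-cancel : ∀ j {a b} → shift j a ≈ᶻ shift j b → a ≈ᶻ b
  shift-cancel j {a} {b} eq i = trans (sym (shift-high j a i)) (trans (eq (j + i)) (shift-high j b i))

module ℚ₂-Ring where

  open import Defs using (ℤ₂; ℚ₂; _/2^_; num; den; _≈_; _+_; _*_; -_; 0q; shift; bit; 0ᶻ; res)
  open Residues
  open import Data.Nat as ℕ using (ℕ; _^_; _∸_)
  import Data.Nat.Properties as ℕₚ
  open ℕₚ using (^-distribˡ-+-*)
  open import Data.Nat.Tactic.RingSolver using (solve-∀)
  open import Data.Product using (_,_)
  open import Relation.Binary.PropositionalEquality as ≡ using (_≡_; cong)

  -- A wrapper around _≈_, which unfolds to a function type and so cannot be inverted to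
  -- recover the two sides.
  infix 4 _≃_
  record _≃_ (x y : ℚ₂) : Set where
    constructor mk≃
    field ≃⇒≈ : x ≈ y
  open _≃_ public

  2^den : ℚ₂ → ℕ
  2^den x = 2 ^ den x

  numRes : ℚ₂ → ℕ → ℕ
  numRes x = res (num x)

  2^den-+ : ∀ x y w → 2^den (x + y) ℕ.* w ≡ 2^den x ℕ.* 2^den y ℕ.* w
  2^den-+ x y w = cong (ℕ._* w) (^-distribˡ-+-* 2 (den x) (den y))

  2^den-* : ∀ x y w → 2^den (x * y) ℕ.* w ≡ 2^den x ℕ.* 2^den y ℕ.* w
  2^den-* x y w = cong (ℕ._* w) (^-distribˡ-+-* 2 (den x) (den y))

  ≃-intro : ∀ {x y} → (∀ k → 2^den y ℕ.* numRes x k ≡ 2^den x ℕ.* numRes y k [mod2^ k ]) → x ≃ y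
  ≃-intro {x} {y} eq = mk≃ (≈ᶻ-intro (λ k →
    mod-trans (res-shift (den y) (num x) k) (mod-trans (eq k) (mod-sym (res-shift (den x) (num y) k)))))

  ≃-elim : ∀ {x y} → x ≃ y → ∀ k → 2^den y ℕ.* numRes x k ≡ 2^den x ℕ.* numRes y k [mod2^ k ]
  ≃-elim {x} {y} (mk≃ x≈y) k =
    mod-trans (mod-sym (res-shift (den y) (num x) k)) (mod-trans (≈ᶻ-elim x≈y k) (res-shift (den x) (num y) k))

  ≃-via : ∀ {x y} (A B : ℕ → ℕ) →
          (∀ k → 2^den y ℕ.* numRes x k ≡ A k [mod2^ k ]) →
          (∀ k → 2^den x ℕ.* numRes y k ≡ B k [mod2^ k ]) →
          (∀ k → A k ≡ B k [mod2^ k ]) → x ≃ y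
  ≃-via A B l r e = ≃-intro (λ k → mod-trans (l k) (mod-trans (e k) (mod-sym (r k))))

  numRes-+ : ∀ x y k → numRes (x + y) k ≡ 2^den y ℕ.* numRes x k ℕ.+ 2^den x ℕ.* numRes y k [mod2^ k ]
  numRes-+ x y k = mod-trans (res-+ᶻ (shift (den y) (num x)) (shift (den x) (num y)) k)
                             (+-cong-mod (res-shift (den y) (num x) k) (res-shift (den x) (num y) k))

  numRes-* : ∀ x y k → numRes (x * y) k ≡ numRes x k ℕ.* numRes y k [mod2^ k ]
  numRes-* x y = res-*ᶻ (num x) (num y)

  ≃-refl : ∀ {x} → x ≃ x
  ≃-refl = mk≃ (λ _ → ≡.refl)

  ≃-sym : ∀ {x y} → x ≃ y → y ≃ x
  ≃-sym (mk≃ x≈y) = mk≃ (λ i → ≡.sym (x≈y i))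

  -- Both sides are multiplied by 2^den y, which can then be cancelled.
  ≃-trans : ∀ {x y z} → x ≃ y → y ≃ z → x ≃ z
  ≃-trans {x} {y} {z} x≃y y≃z = mk≃ (shift-cancel (den y) (≈ᶻ-intro chain))
    where
    a b c : ℤ₂
    a = num x ; b = num y ; c = num z
    m n p : ℕ
    m = den x ; n = den y ; p = den z
    swap : ∀ u v w → u ℕ.* (v ℕ.* w) ≡ v ℕ.* (u ℕ.* w)
    swap = solve-∀
    chain : ∀ k → res (shift n (shift p a)) k ≡ res (shift n (shift m c)) k [mod2^ k ]
    chain k = begin
        res (shift n (shift p a)) k     ≈⟨ res-shift n _ k ⟩
        2 ^ n ℕ.* res (shift p a) k     ≈⟨ *-congˡ-mod (2 ^ n) (res-shift p a k) ⟩
        2 ^ n ℕ.* (2 ^ p ℕ.* res a k)   ≡⟨ swap (2 ^ n) (2 ^ p) (res a k) ⟩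
        2 ^ p ℕ.* (2 ^ n ℕ.* res a k)   ≈⟨ *-congˡ-mod (2 ^ p) (≃-elim x≃y k) ⟩
        2 ^ p ℕ.* (2 ^ m ℕ.* res b k)   ≡⟨ swap (2 ^ p) (2 ^ m) (res b k) ⟩
        2 ^ m ℕ.* (2 ^ p ℕ.* res b k)   ≈⟨ *-congˡ-mod (2 ^ m) (≃-elim y≃z k) ⟩
        2 ^ m ℕ.* (2 ^ n ℕ.* res c k)   ≡⟨ swap (2 ^ m) (2 ^ n) (res c k) ⟩
        2 ^ n ℕ.* (2 ^ m ℕ.* res c k)   ≈⟨ *-congˡ-mod (2 ^ n) (res-shift m c k) ⟨
        2 ^ n ℕ.* res (shift m c) k     ≈⟨ res-shift n _ k ⟨
        res (shift n (shift m c)) k     ∎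
      where open mod2^-Reasoning k

  +-comm : ∀ x y → x + y ≃ y + x
  +-comm x y = ≃-via _ _
    (λ k → *-congˡ-mod (2^den (y + x)) (numRes-+ x y k))
    (λ k → *-congˡ-mod (2^den (x + y)) (numRes-+ y x k))
    (λ k → ≡⇒≡mod (≡.trans (2^den-+ y x _) (≡.trans (swap (2^den y) (2^den x) (numRes x k) (numRes y k))
                                                      (≡.sym (2^den-+ x y _)))))
    where swap : ∀ u v a b → u ℕ.* v ℕ.* (u ℕ.* a ℕ.+ v ℕ.* b) ≡ v ℕ.* u ℕ.* (v ℕ.* b ℕ.+ u ℕ.* a)
          swap = solve-∀

  *-comm : ∀ x y → x * y ≃ y * x
  *-comm x y = ≃-via _ _
    (λ k → *-congˡ-mod (2^den (y * x)) (numRes-* x y k))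
    (λ k → *-congˡ-mod (2^den (x * y)) (numRes-* y x k))
    (λ k → ≡⇒≡mod (≡.trans (2^den-* y x _) (≡.trans (swap (2^den y) (2^den x) (numRes x k) (numRes y k))
                                                      (≡.sym (2^den-* x y _)))))
    where swap : ∀ u v a b → u ℕ.* v ℕ.* (a ℕ.* b) ≡ v ℕ.* u ℕ.* (b ℕ.* a)
          swap = solve-∀

  +-congˡ : ∀ {x x'} y → x ≃ x' → x + y ≃ x' + y
  +-congˡ {x} {x'} y x≃x' = ≃-via _ _
    (λ k → *-congˡ-mod (2^den (x' + y)) (numRes-+ x y k))
    (λ k → *-congˡ-mod (2^den (x + y)) (numRes-+ x' y k))
    (λ k → let open mod2^-Reasoning k in begin
        2^den (x' + y) ℕ.* (n ℕ.* numRes x k ℕ.+ m ℕ.* numRes y k)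
          ≡⟨ 2^den-+ x' y _ ⟩
        m' ℕ.* n ℕ.* (n ℕ.* numRes x k ℕ.+ m ℕ.* numRes y k)
          ≡⟨ expand m' n m (numRes x k) (numRes y k) ⟩
        n ℕ.* n ℕ.* (m' ℕ.* numRes x k) ℕ.+ m' ℕ.* n ℕ.* m ℕ.* numRes y k
          ≈⟨ +-cong-mod (*-congˡ-mod (n ℕ.* n) (≃-elim x≃x' k)) mod-refl ⟩
        n ℕ.* n ℕ.* (m ℕ.* numRes x' k) ℕ.+ m' ℕ.* n ℕ.* m ℕ.* numRes y k
          ≡⟨ collect m' n m (numRes x' k) (numRes y k) ⟩
        m ℕ.* n ℕ.* (n ℕ.* numRes x' k ℕ.+ m' ℕ.* numRes y k)
          ≡⟨ 2^den-+ x y _ ⟨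
        2^den (x + y) ℕ.* (n ℕ.* numRes x' k ℕ.+ m' ℕ.* numRes y k)
          ∎)
    where
    m n m' : ℕ
    m = 2^den x ; n = 2^den y ; m' = 2^den x'
    expand : ∀ u v w a b → u ℕ.* v ℕ.* (v ℕ.* a ℕ.+ w ℕ.* b) ≡ v ℕ.* v ℕ.* (u ℕ.* a) ℕ.+ u ℕ.* v ℕ.* w ℕ.* b
    expand = solve-∀
    collect : ∀ u v w a b → v ℕ.* v ℕ.* (w ℕ.* a) ℕ.+ u ℕ.* v ℕ.* w ℕ.* b ≡ w ℕ.* v ℕ.* (v ℕ.* a ℕ.+ u ℕ.* b)
    collect = solve-∀

  *-congˡ : ∀ {x x'} y → x ≃ x' → x * y ≃ x' * y
  *-congˡ {x} {x'} y x≃x' = ≃-via _ _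
    (λ k → *-congˡ-mod (2^den (x' * y)) (numRes-* x y k))
    (λ k → *-congˡ-mod (2^den (x * y)) (numRes-* x' y k))
    (λ k → let open mod2^-Reasoning k in begin
        2^den (x' * y) ℕ.* (numRes x k ℕ.* numRes y k)    ≡⟨ 2^den-* x' y _ ⟩
        m' ℕ.* n ℕ.* (numRes x k ℕ.* numRes y k)          ≡⟨ expand m' n (numRes x k) (numRes y k) ⟩
        n ℕ.* numRes y k ℕ.* (m' ℕ.* numRes x k)          ≈⟨ *-congˡ-mod (n ℕ.* numRes y k) (≃-elim x≃x' k) ⟩
        n ℕ.* numRes y k ℕ.* (m ℕ.* numRes x' k)          ≡⟨ collect m n (numRes x' k) (numRes y k) ⟩
        m ℕ.* n ℕ.* (numRes x' k ℕ.* numRes y k)          ≡⟨ 2^den-* x y _ ⟨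
        2^den (x * y) ℕ.* (numRes x' k ℕ.* numRes y k)    ∎)
    where
    m n m' : ℕ
    m = 2^den x ; n = 2^den y ; m' = 2^den x'
    expand : ∀ u v a b → u ℕ.* v ℕ.* (a ℕ.* b) ≡ v ℕ.* b ℕ.* (u ℕ.* a)
    expand = solve-∀
    collect : ∀ w v a b → v ℕ.* b ℕ.* (w ℕ.* a) ≡ w ℕ.* v ℕ.* (a ℕ.* b)
    collect = solve-∀

  +-cong : ∀ {x x' y y'} → x ≃ x' → y ≃ y' → x + y ≃ x' + y'
  +-cong {x' = x'} {y} {y'} x≃x' y≃y' =
    ≃-trans (+-congˡ y x≃x') (≃-trans (+-comm x' y) (≃-trans (+-congˡ x' y≃y') (+-comm y' x')))

  *-cong : ∀ {x x' y y'} → x ≃ x' → y ≃ y' → x * y ≃ x' * y'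
  *-cong {x' = x'} {y} {y'} x≃x' y≃y' =
    ≃-trans (*-congˡ y x≃x') (≃-trans (*-comm x' y) (≃-trans (*-congˡ x' y≃y') (*-comm y' x')))

  +-assoc : ∀ x y z → (x + y) + z ≃ x + (y + z)
  +-assoc x y z = ≃-via _ _
    (λ k → *-congˡ-mod (2^den (x + (y + z)))
             (mod-trans (numRes-+ (x + y) z k) (+-cong-mod (*-congˡ-mod (2^den z) (numRes-+ x y k)) mod-refl)))
    (λ k → *-congˡ-mod (2^den ((x + y) + z))
             (mod-trans (numRes-+ x (y + z) k) (+-cong-mod mod-refl (*-congˡ-mod (2^den x) (numRes-+ y z k)))))
    (λ k → ≡⇒≡mod (normalise (numRes x k) (numRes y k) (numRes z k)))
    where
    m n p : ℕ
    m = den x ; n = den y ; p = den z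
    normalise : ∀ a b c →
      2 ^ (m ℕ.+ (n ℕ.+ p)) ℕ.* (2 ^ p ℕ.* (2 ^ n ℕ.* a ℕ.+ 2 ^ m ℕ.* b) ℕ.+ 2 ^ (m ℕ.+ n) ℕ.* c)
      ≡ 2 ^ (m ℕ.+ n ℕ.+ p) ℕ.* (2 ^ (n ℕ.+ p) ℕ.* a ℕ.+ 2 ^ m ℕ.* (2 ^ p ℕ.* b ℕ.+ 2 ^ n ℕ.* c))
    normalise a b c rewrite ^-distribˡ-+-* 2 m (n ℕ.+ p) | ^-distribˡ-+-* 2 n p
                          | ^-distribˡ-+-* 2 (m ℕ.+ n) p | ^-distribˡ-+-* 2 m n = lemma (2 ^ m) (2 ^ n) (2 ^ p) a b c
      where lemma : ∀ u v w a b c → u ℕ.* (v ℕ.* w) ℕ.* (w ℕ.* (v ℕ.* a ℕ.+ u ℕ.* b) ℕ.+ u ℕ.* v ℕ.* c)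
                                  ≡ u ℕ.* v ℕ.* w ℕ.* (v ℕ.* w ℕ.* a ℕ.+ u ℕ.* (w ℕ.* b ℕ.+ v ℕ.* c))
            lemma = solve-∀

  *-assoc : ∀ x y z → (x * y) * z ≃ x * (y * z)
  *-assoc x y z = ≃-via _ _
    (λ k → *-congˡ-mod (2^den (x * (y * z)))
             (mod-trans (numRes-* (x * y) z k) (*-cong-mod (numRes-* x y k) mod-refl)))
    (λ k → *-congˡ-mod (2^den ((x * y) * z))
             (mod-trans (numRes-* x (y * z) k) (*-congˡ-mod (numRes x k) (numRes-* y z k))))
    (λ k → ≡⇒≡mod (normalise (numRes x k) (numRes y k) (numRes z k)))
    where
    m n p : ℕ
    m = den x ; n = den y ; p = den z
    normalise : ∀ a b c → 2 ^ (m ℕ.+ (n ℕ.+ p)) ℕ.* (a ℕ.* b ℕ.* c) ≡ 2 ^ (m ℕ.+ n ℕ.+ p) ℕ.* (a ℕ.* (b ℕ.* c))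
    normalise a b c rewrite ^-distribˡ-+-* 2 m (n ℕ.+ p) | ^-distribˡ-+-* 2 n p
                          | ^-distribˡ-+-* 2 (m ℕ.+ n) p | ^-distribˡ-+-* 2 m n = lemma (2 ^ m) (2 ^ n) (2 ^ p) a b c
      where lemma : ∀ u v w a b c → u ℕ.* (v ℕ.* w) ℕ.* (a ℕ.* b ℕ.* c) ≡ u ℕ.* v ℕ.* w ℕ.* (a ℕ.* (b ℕ.* c))
            lemma = solve-∀

  *-distribˡ-+ : ∀ x y z → x * (y + z) ≃ x * y + x * z
  *-distribˡ-+ x y z = ≃-via _ _
    (λ k → *-congˡ-mod (2^den (x * y + x * z))
             (mod-trans (numRes-* x (y + z) k) (*-congˡ-mod (numRes x k) (numRes-+ y z k))))
    (λ k → *-congˡ-mod (2^den (x * (y + z)))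
             (mod-trans (numRes-+ (x * y) (x * z) k)
                        (+-cong-mod (*-congˡ-mod (2^den (x * z)) (numRes-* x y k))
                                    (*-congˡ-mod (2^den (x * y)) (numRes-* x z k)))))
    (λ k → ≡⇒≡mod (normalise (numRes x k) (numRes y k) (numRes z k)))
    where
    m n p : ℕ
    m = den x ; n = den y ; p = den z
    normalise : ∀ a b c → 2 ^ (m ℕ.+ n ℕ.+ (m ℕ.+ p)) ℕ.* (a ℕ.* (2 ^ p ℕ.* b ℕ.+ 2 ^ n ℕ.* c))
                        ≡ 2 ^ (m ℕ.+ (n ℕ.+ p)) ℕ.* (2 ^ (m ℕ.+ p) ℕ.* (a ℕ.* b) ℕ.+ 2 ^ (m ℕ.+ n) ℕ.* (a ℕ.* c))
    normalise a b c rewrite ^-distribˡ-+-* 2 (m ℕ.+ n) (m ℕ.+ p) | ^-distribˡ-+-* 2 m (n ℕ.+ p)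
                          | ^-distribˡ-+-* 2 n p | ^-distribˡ-+-* 2 m p | ^-distribˡ-+-* 2 m n
                          = lemma (2 ^ m) (2 ^ n) (2 ^ p) a b c
      where lemma : ∀ u v w a b c → u ℕ.* v ℕ.* (u ℕ.* w) ℕ.* (a ℕ.* (w ℕ.* b ℕ.+ v ℕ.* c))
                                  ≡ u ℕ.* (v ℕ.* w) ℕ.* (u ℕ.* w ℕ.* (a ℕ.* b) ℕ.+ u ℕ.* v ℕ.* (a ℕ.* c))
            lemma = solve-∀

  +-identityˡ : ∀ x → 0q + x ≃ x
  +-identityˡ x = ≃-via _ _
    (λ k → *-congˡ-mod (2^den x) (numRes-+ 0q x k))
    (λ k → mod-refl)
    (λ k → ≡⇒≡mod (normalise (numRes x k) (res-0ᶻ k)))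
    where
    normalise : ∀ a {r₀} → r₀ ≡ 0 → 2^den x ℕ.* (2^den x ℕ.* r₀ ℕ.+ 1 ℕ.* a) ≡ 2^den x ℕ.* a
    normalise a ≡.refl = lemma (2^den x) a
      where lemma : ∀ u a → u ℕ.* (u ℕ.* 0 ℕ.+ 1 ℕ.* a) ≡ u ℕ.* a
            lemma = solve-∀

  1q : ℚ₂
  1q = bit 1 /2^ 0

  *-identityˡ : ∀ x → 1q * x ≃ x
  *-identityˡ x = ≃-via _ _
    (λ k → *-congˡ-mod (2^den x) (mod-trans (numRes-* 1q x k) (*-cong-mod (res-bit 1 k) mod-refl)))
    (λ k → mod-refl)
    (λ k → ≡⇒≡mod (lemma (2^den x) (numRes x k)))
    where lemma : ∀ u a → u ℕ.* (1 ℕ.* a) ≡ u ℕ.* a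
          lemma = solve-∀

  2^j*[2^k∸r]+2^j*r≡0 : ∀ x j k → 2 ^ j ℕ.* (2 ^ k ∸ numRes x k) ℕ.+ 2 ^ j ℕ.* numRes x k ≡ 0 [mod2^ k ]
  2^j*[2^k∸r]+2^j*r≡0 x j k = begin
      2 ^ j ℕ.* (2 ^ k ∸ numRes x k) ℕ.+ 2 ^ j ℕ.* numRes x k  ≡⟨ ℕₚ.*-distribˡ-+ (2 ^ j) _ _ ⟨
      2 ^ j ℕ.* (2 ^ k ∸ numRes x k ℕ.+ numRes x k)            ≈⟨ *-congˡ-mod (2 ^ j) (res-∸+ (num x) k) ⟩
      2 ^ j ℕ.* 0                                              ≡⟨ ℕₚ.*-zeroʳ (2 ^ j) ⟩
      0                                                        ∎
    where open mod2^-Reasoning k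

  -‿inverseˡ : ∀ x → (- x) + x ≃ 0q
  -‿inverseˡ x = ≃-via _ _
    (λ k → *-congˡ-mod 1
             (mod-trans (numRes-+ (- x) x k) (+-cong-mod (*-congˡ-mod (2^den x) (res--ᶻ (num x) k)) mod-refl)))
    (λ k → mod-refl)
    (λ k → let open mod2^-Reasoning k in begin
        1 ℕ.* (2^den x ℕ.* (2 ^ k ∸ numRes x k) ℕ.+ 2^den x ℕ.* numRes x k)
          ≈⟨ *-congˡ-mod 1 (2^j*[2^k∸r]+2^j*r≡0 x (den x) k) ⟩
        1 ℕ.* 0
          ≡⟨ ℕₚ.*-zeroʳ (2^den (- x + x)) ⟨
        2^den (- x + x) ℕ.* 0
          ≡⟨ cong (2^den (- x + x) ℕ.*_) (res-0ᶻ k) ⟨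
        2^den (- x + x) ℕ.* res 0ᶻ k
          ∎)

  -‿cong : ∀ {x x'} → x ≃ x' → - x ≃ - x'
  -‿cong {x} {x'} x≃x' = ≃-intro (λ k → +-cancelʳ-mod (sum≡sum k) (≃-elim x≃x' k))
    where
    sum≡sum : ∀ k → 2^den x' ℕ.* numRes (- x) k ℕ.+ 2^den x' ℕ.* numRes x k
                ≡ 2^den x ℕ.* numRes (- x') k ℕ.+ 2^den x ℕ.* numRes x' k [mod2^ k ]
    sum≡sum k = begin
        2^den x' ℕ.* numRes (- x) k ℕ.+ 2^den x' ℕ.* numRes x k
          ≈⟨ +-cong-mod (*-congˡ-mod (2^den x') (res--ᶻ (num x) k)) mod-refl ⟩
        2^den x' ℕ.* (2 ^ k ∸ numRes x k) ℕ.+ 2^den x' ℕ.* numRes x k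
          ≈⟨ 2^j*[2^k∸r]+2^j*r≡0 x (den x') k ⟩
        0
          ≈⟨ 2^j*[2^k∸r]+2^j*r≡0 x' (den x) k ⟨
        2^den x ℕ.* (2 ^ k ∸ numRes x' k) ℕ.+ 2^den x ℕ.* numRes x' k
          ≈⟨ +-cong-mod (*-congˡ-mod (2^den x) (res--ᶻ (num x') k)) mod-refl ⟨
        2^den x ℕ.* numRes (- x') k ℕ.+ 2^den x ℕ.* numRes x' k
          ∎
      where open mod2^-Reasoning k

  ℚ₂-commutativeRing : CommutativeRing 0ℓ 0ℓ
  ℚ₂-commutativeRing = record
    { Carrier = ℚ₂ ; _≈_ = _≃_ ; _+_ = _+_ ; _*_ = _*_ ; -_ = -_ ; 0# = 0q ; 1# = 1q
    ; isCommutativeRing = record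
      { isRing = record
        { +-isAbelianGroup = record
          { isGroup = record
            { isMonoid = record
              { isSemigroup = record
                { isMagma = record
                  { isEquivalence = record { refl = ≃-refl ; sym = ≃-sym ; trans = ≃-trans }
                  ; ∙-cong = +-cong }
                ; assoc = +-assoc }
              ; identity = +-identityˡ , λ x → ≃-trans (+-comm x 0q) (+-identityˡ x) }
            ; inverse = -‿inverseˡ , λ x → ≃-trans (+-comm x (- x)) (-‿inverseˡ x)
            ; ⁻¹-cong = -‿cong }
          ; comm = +-comm }
        ; *-cong = *-cong
        ; *-assoc = *-assoc
        ; *-identity = *-identityˡ , λ x → ≃-trans (*-comm x 1q) (*-identityˡ x)
        ; distrib = *-distribˡ-+ , λ x y z → ≃-trans (*-comm (y + z) x)
                                             (≃-trans (*-distribˡ-+ x y z) (+-cong (*-comm x y) (*-comm x z))) }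
      ; *-comm = *-comm } }

module Forms (CR : CommutativeRing 0ℓ 0ℓ) where

  open import Data.Nat as ℕ using (ℕ; zero; suc)
  open import Data.Fin using (Fin; _↑ˡ_; _↑ʳ_) renaming (zero to fzero; suc to fsuc)
  open import Data.Product using (_×_; _,_)
  open import Data.Vec.Functional using (Vector; _∷_; _++_; head; tail)
  open import Data.Vec.Functional.Properties using (lookup-++ˡ; lookup-++ʳ)
  open CommutativeRing CR renaming (Carrier to R) hiding (zero)
  open import Algebra.Properties.Semiring.Sum semiring
    using (sum; sum-cong-≋; ∑-distrib-+; *-distribˡ-sum; *-distribʳ-sum; sum-replicate-zero)
  open import Algebra.Solver.Ring.NaturalCoefficients.Default commutativeSemiring
  open import Relation.Binary.Reasoning.Setoid setoid
  import Relation.Binary.PropositionalEquality as ≡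

  -- With the length explicit: unification cannot recover n from sum {n} f.
  ∑ : (n : ℕ) → Vector R n → R
  ∑ n = sum {n}

  ∑-cong : ∀ n {f g : Vector R n} → (∀ i → f i ≈ g i) → ∑ n f ≈ ∑ n g
  ∑-cong n = sum-cong-≋ {n}

  ∑-+ : ∀ n (f g : Vector R n) → ∑ n (λ i → f i + g i) ≈ ∑ n f + ∑ n g
  ∑-+ n = ∑-distrib-+ {n}

  ∑-*ˡ : ∀ n c (f : Vector R n) → ∑ n (λ i → c * f i) ≈ c * ∑ n f
  ∑-*ˡ n c f = sym (*-distribˡ-sum {n} c f)

  ∑-*ʳ : ∀ n c (f : Vector R n) → ∑ n (λ i → f i * c) ≈ ∑ n f * c
  ∑-*ʳ n c f = sym (*-distribʳ-sum {n} c f)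

  ∑-0 : ∀ n {f : Vector R n} → (∀ i → f i ≈ 0#) → ∑ n f ≈ 0#
  ∑-0 n f≈0 = trans (∑-cong n f≈0) (sum-replicate-zero n)

  ∑-+-*ˡ : ∀ n (f g : Vector R n) t → ∑ n (λ i → f i + t * g i) ≈ ∑ n f + t * ∑ n g
  ∑-+-*ˡ n f g t = trans (∑-+ n f _) (+-congˡ (∑-*ˡ n t g))

  Form : ℕ → ℕ → Set
  Form zero    k = R
  Form (suc d) k = Fin k → Form d k

  scaleᶠ : ∀ d {k} → Form d k → R → Form d k
  scaleᶠ zero    c s = c * s
  scaleᶠ (suc d) c s = λ i → scaleᶠ d (c i) s

  addᶠ : ∀ d {k} → Form d k → Form d k → Form d k
  addᶠ zero    c c' = c + c'
  addᶠ (suc d) c c' = λ i → addᶠ d (c i) (c' i)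

  ≈ᶠ : ∀ d {k} → Form d k → Form d k → Set
  ≈ᶠ zero    c c' = c ≈ c'
  ≈ᶠ (suc d) c c' = ∀ i → ≈ᶠ d (c i) (c' i)

  -- The variables are multiplied in at the leaves, so that eval 4 c y unfolds to
  -- ∑ c i j l m * y i * y j * y l * y m, the shape used by Defs.evalF.
  eval : ∀ d {k} → Form d k → Vector R k → R
  eval zero    c y = c
  eval (suc d) {k} c y = ∑ k (λ i → eval d (scaleᶠ d (c i) (y i)) y)

  ≈ᶠ-refl : ∀ d {k} (c : Form d k) → ≈ᶠ d c c
  ≈ᶠ-refl zero    c = refl
  ≈ᶠ-refl (suc d) c i = ≈ᶠ-refl d (c i)

  scaleᶠ-cong : ∀ d {k} {c c' : Form d k} {s s'} → ≈ᶠ d c c' → s ≈ s' → ≈ᶠ d (scaleᶠ d c s) (scaleᶠ d c' s')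
  scaleᶠ-cong zero    c≈c' s≈s' = *-cong c≈c' s≈s'
  scaleᶠ-cong (suc d) c≈c' s≈s' i = scaleᶠ-cong d (c≈c' i) s≈s'

  scaleᶠ-comm : ∀ d {k} (c : Form d k) s t → ≈ᶠ d (scaleᶠ d (scaleᶠ d c s) t) (scaleᶠ d (scaleᶠ d c t) s)
  scaleᶠ-comm zero    c s t = trans (*-assoc c s t) (trans (*-congˡ (*-comm s t)) (sym (*-assoc c t s)))
  scaleᶠ-comm (suc d) c s t i = scaleᶠ-comm d (c i) s t

  scaleᶠ-addᶠ : ∀ d {k} (c c' : Form d k) s → ≈ᶠ d (scaleᶠ d (addᶠ d c c') s) (addᶠ d (scaleᶠ d c s) (scaleᶠ d c' s))
  scaleᶠ-addᶠ zero    c c' s = distribʳ s c c'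
  scaleᶠ-addᶠ (suc d) c c' s i = scaleᶠ-addᶠ d (c i) (c' i) s

  eval-congˡ : ∀ d {k} {c c' : Form d k} y → ≈ᶠ d c c' → eval d c y ≈ eval d c' y
  eval-congˡ zero    y c≈c' = c≈c'
  eval-congˡ (suc d) {k} y c≈c' = ∑-cong k (λ i → eval-congˡ d y (scaleᶠ-cong d (c≈c' i) refl))

  eval-congʳ : ∀ d {k} (c : Form d k) {y y'} → (∀ i → y i ≈ y' i) → eval d c y ≈ eval d c y'
  eval-congʳ zero    c y≈y' = refl
  eval-congʳ (suc d) {k} c {y} y≈y' =
    ∑-cong k (λ i → trans (eval-congˡ d y (scaleᶠ-cong d (≈ᶠ-refl d (c i)) (y≈y' i))) (eval-congʳ d _ y≈y'))

  eval-scaleᶠ : ∀ d {k} (c : Form d k) s y → eval d (scaleᶠ d c s) y ≈ eval d c y * s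
  eval-scaleᶠ zero    c s y = refl
  eval-scaleᶠ (suc d) {k} c s y = begin
      ∑ k (λ i → eval d (scaleᶠ d (scaleᶠ d (c i) s) (y i)) y)
        ≈⟨ ∑-cong k (λ i → eval-congˡ d y (scaleᶠ-comm d (c i) s (y i))) ⟩
      ∑ k (λ i → eval d (scaleᶠ d (scaleᶠ d (c i) (y i)) s) y)
        ≈⟨ ∑-cong k (λ i → eval-scaleᶠ d (scaleᶠ d (c i) (y i)) s y) ⟩
      ∑ k (λ i → eval d (scaleᶠ d (c i) (y i)) y * s)
        ≈⟨ ∑-*ʳ k s _ ⟩
      eval (suc d) c y * s
        ∎

  eval-addᶠ : ∀ d {k} (c c' : Form d k) y → eval d (addᶠ d c c') y ≈ eval d c y + eval d c' y
  eval-addᶠ zero    c c' y = refl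
  eval-addᶠ (suc d) {k} c c' y = begin
      ∑ k (λ i → eval d (scaleᶠ d (addᶠ d (c i) (c' i)) (y i)) y)
        ≈⟨ ∑-cong k (λ i → eval-congˡ d y (scaleᶠ-addᶠ d (c i) (c' i) (y i))) ⟩
      ∑ k (λ i → eval d (addᶠ d (scaleᶠ d (c i) (y i)) (scaleᶠ d (c' i) (y i))) y)
        ≈⟨ ∑-cong k (λ i → eval-addᶠ d (scaleᶠ d (c i) (y i)) (scaleᶠ d (c' i) (y i)) y) ⟩
      ∑ k (λ i → eval d (scaleᶠ d (c i) (y i)) y + eval d (scaleᶠ d (c' i) (y i)) y)
        ≈⟨ ∑-+ k _ _ ⟩
      eval (suc d) c y + eval (suc d) c' y
        ∎

  eval-suc : ∀ d {k} (c : Form (suc d) k) y → eval (suc d) c y ≈ ∑ k (λ i → eval d (c i) y * y i)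
  eval-suc d {k} c y = ∑-cong k (λ i → eval-scaleᶠ d (c i) (y i) y)

  record LinearFunctional (I : Set) : Set where
    field
      Λ      : (I → R) → R
      Λ-cong : ∀ {f g : I → R} → (∀ i → f i ≈ g i) → Λ f ≈ Λ g
      Λ-+    : ∀ (f g : I → R) → Λ (λ i → f i + g i) ≈ Λ f + Λ g
      Λ-*ʳ   : ∀ (f : I → R) s → Λ (λ i → f i * s) ≈ Λ f * s

  module LinearFunctionalProperties {I : Set} (L : LinearFunctional I) where
    open LinearFunctional L public

    Λ-0 : Λ (λ _ → 0#) ≈ 0#
    Λ-0 = begin
      Λ (λ _ → 0#)       ≈⟨ Λ-cong (λ _ → sym (zeroˡ 0#)) ⟩
      Λ (λ _ → 0# * 0#)  ≈⟨ Λ-*ʳ (λ _ → 0#) 0# ⟩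
      Λ (λ _ → 0#) * 0#  ≈⟨ zeroʳ _ ⟩
      0#                 ∎

    Λ-*ˡ : ∀ t (f : I → R) → Λ (λ v → t * f v) ≈ t * Λ f
    Λ-*ˡ t f = trans (Λ-cong (λ v → *-comm t (f v))) (trans (Λ-*ʳ f t) (*-comm _ t))

    Λ-∑ : ∀ m (f : I → Vector R m) → Λ (λ i → ∑ m (f i)) ≈ ∑ m (λ b → Λ (λ i → f i b))
    Λ-∑ zero    f = Λ-0
    Λ-∑ (suc m) f = trans (Λ-+ _ _) (+-congˡ (Λ-∑ m (λ i b → f i (fsuc b))))

    Λ-+-*ˡ-0 : ∀ {A B : I → R} t → Λ A ≈ 0# → Λ B ≈ 0# → Λ (λ v → A v + t * B v) ≈ 0#
    Λ-+-*ˡ-0 {A} {B} t ΛA≈0 ΛB≈0 = begin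
      Λ (λ v → A v + t * B v)  ≈⟨ Λ-+ A _ ⟩
      Λ A + Λ (λ v → t * B v)  ≈⟨ +-cong ΛA≈0 (trans (Λ-*ˡ t B) (trans (*-congˡ ΛB≈0) (zeroʳ t))) ⟩
      0# + 0#                  ≈⟨ +-identityʳ 0# ⟩
      0#                       ∎

    Λ-++ˡ-0 : ∀ {m n} (F : I → Vector R m) (G : I → Vector R n) →
              (∀ ι → Λ (λ v → (F v ++ G v) ι) ≈ 0#) → ∀ ι → Λ (λ v → F v ι) ≈ 0#
    Λ-++ˡ-0 {n = n} F G Λ≈0 ι = trans (Λ-cong (λ v → reflexive (≡.sym (lookup-++ˡ (F v) (G v) ι)))) (Λ≈0 (ι ↑ˡ n))

    Λ-++ʳ-0 : ∀ {m n} (F : I → Vector R m) (G : I → Vector R n) →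
              (∀ ι → Λ (λ v → (F v ++ G v) ι) ≈ 0#) → ∀ ι → Λ (λ v → G v ι) ≈ 0#
    Λ-++ʳ-0 {m} F G Λ≈0 ι = trans (Λ-cong (λ v → reflexive (≡.sym (lookup-++ʳ (F v) (G v) ι)))) (Λ≈0 (m ↑ʳ ι))

    Λᶠ : ∀ d {k} → (I → Form d k) → Form d k
    Λᶠ zero    V = Λ V
    Λᶠ (suc d) V = λ b → Λᶠ d (λ i → V i b)

    Λᶠ-scaleᶠ : ∀ d {k} (V : I → Form d k) s → ≈ᶠ d (scaleᶠ d (Λᶠ d V) s) (Λᶠ d (λ i → scaleᶠ d (V i) s))
    Λᶠ-scaleᶠ zero    V s = sym (Λ-*ʳ V s)
    Λᶠ-scaleᶠ (suc d) V s b = Λᶠ-scaleᶠ d (λ i → V i b) s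

    eval-Λᶠ : ∀ d {k} (V : I → Form d k) y → eval d (Λᶠ d V) y ≈ Λ (λ i → eval d (V i) y)
    eval-Λᶠ zero    V y = refl
    eval-Λᶠ (suc d) {k} V y = begin
        ∑ k (λ b → eval d (scaleᶠ d (Λᶠ d (λ i → V i b)) (y b)) y)
          ≈⟨ ∑-cong k (λ b → eval-congˡ d y (Λᶠ-scaleᶠ d (λ i → V i b) (y b))) ⟩
        ∑ k (λ b → eval d (Λᶠ d (λ i → scaleᶠ d (V i b) (y b))) y)
          ≈⟨ ∑-cong k (λ b → eval-Λᶠ d (λ i → scaleᶠ d (V i b) (y b)) y) ⟩
        ∑ k (λ b → Λ (λ i → eval d (scaleᶠ d (V i b) (y b)) y))
          ≈⟨ Λ-∑ k (λ i b → eval d (scaleᶠ d (V i b) (y b)) y) ⟨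
        Λ (λ i → eval (suc d) (V i) y)
          ∎

  ∷-head-tail : ∀ {k} (x : Vector R (suc k)) i → x i ≈ (head x ∷ tail x) i
  ∷-head-tail x fzero    = refl
  ∷-head-tail x (fsuc i) = refl

  eval₁-0 : ∀ {k} (c : Form 1 k) y → (∀ i → c i ≈ 0#) → eval 1 c y ≈ 0#
  eval₁-0 {k} c y c≈0 = ∑-0 k (λ i → trans (*-congʳ (c≈0 i)) (zeroˡ (y i)))

  eval₁-∷ : ∀ {k} (c : Form 1 (suc k)) t x → eval 1 c (t ∷ x) ≈ eval 1 (tail c) x + t * head c
  eval₁-∷ c t x = trans (+-comm _ _) (+-congˡ (*-comm (head c) t))

  Q₀ : ∀ {k} → Form 2 (suc k) → Form 2 k
  Q₀ c i j = c (fsuc i) (fsuc j)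

  Q₁ : ∀ {k} → Form 2 (suc k) → Form 1 k
  Q₁ c i = c fzero (fsuc i) + c (fsuc i) fzero

  Q₂ : ∀ {k} → Form 2 (suc k) → Form 0 k
  Q₂ c = c fzero fzero

  eval₂-∷ : ∀ {k} (c : Form 2 (suc k)) t x →
            eval 2 c (t ∷ x) ≈ eval 2 (Q₀ c) x + t * eval 1 (Q₁ c) x + (t * t) * Q₂ c
  eval₂-∷ {k} c t x = begin
      eval 2 c (t ∷ x)
        ≈⟨ eval-suc 1 c (t ∷ x) ⟩
      eval 1 (c fzero) (t ∷ x) * t + ∑ k (λ i → eval 1 (c (fsuc i)) (t ∷ x) * x i)
        ≈⟨ +-cong (*-congʳ (eval₁-∷ (c fzero) t x)) (∑-cong k (λ i → *-congʳ (eval₁-∷ (c (fsuc i)) t x))) ⟩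
      (a + t * Q₂ c) * t + ∑ k (λ i → (eval 1 (Q₀ c i) x + t * c (fsuc i) fzero) * x i)
        ≈⟨ +-congˡ (∑-cong k (λ i → trans (distribʳ (x i) _ _) (+-congˡ (*-assoc t _ (x i))))) ⟩
      (a + t * Q₂ c) * t + ∑ k (λ i → eval 1 (Q₀ c i) x * x i + t * (c (fsuc i) fzero * x i))
        ≈⟨ +-congˡ (∑-+-*ˡ k _ _ t) ⟩
      (a + t * Q₂ c) * t + (∑ k (λ i → eval 1 (Q₀ c i) x * x i) + t * b)
        ≈⟨ +-congˡ (+-congʳ (eval-suc 1 (Q₀ c) x)) ⟨
      (a + t * Q₂ c) * t + (eval 2 (Q₀ c) x + t * b)
        ≈⟨ regroup a (Q₂ c) (eval 2 (Q₀ c) x) b t ⟩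
      eval 2 (Q₀ c) x + t * (a + b) + (t * t) * Q₂ c
        ≈⟨ +-congʳ (+-congˡ (*-congˡ (eval-addᶠ 1 (tail (c fzero)) (λ i → c (fsuc i) fzero) x))) ⟨
      eval 2 (Q₀ c) x + t * eval 1 (Q₁ c) x + (t * t) * Q₂ c
        ∎
    where
    a b : R
    a = eval 1 (tail (c fzero)) x
    b = eval 1 (λ i → c (fsuc i) fzero) x
    regroup : ∀ a c e b t → (a + t * c) * t + (e + t * b) ≈ e + t * (a + b) + (t * t) * c
    regroup = solve 5 (λ a c e b t → (a :+ t :* c) :* t :+ (e :+ t :* b) := e :+ t :* (a :+ b) :+ (t :* t) :* c) refl

  C₀ : ∀ {k} → Form 3 (suc k) → Form 3 k
  C₀ c i = Q₀ (c (fsuc i))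

  C₁ : ∀ {k} → Form 3 (suc k) → Form 2 k
  C₁ c = addᶠ 2 (Q₀ (c fzero)) (λ i → Q₁ (c (fsuc i)))

  C₂ : ∀ {k} → Form 3 (suc k) → Form 1 k
  C₂ c = addᶠ 1 (Q₁ (c fzero)) (λ i → Q₂ (c (fsuc i)))

  C₃ : ∀ {k} → Form 3 (suc k) → Form 0 k
  C₃ c = Q₂ (c fzero)

  eval₃-∷ : ∀ {k} (c : Form 3 (suc k)) t x →
            eval 3 c (t ∷ x) ≈ eval 3 (C₀ c) x + t * eval 2 (C₁ c) x + (t * t) * eval 1 (C₂ c) x + (t * t * t) * C₃ c
  eval₃-∷ {k} c t x = begin
      eval 3 c (t ∷ x)
        ≈⟨ eval-suc 2 c (t ∷ x) ⟩
      eval 2 (c fzero) (t ∷ x) * t + ∑ k (λ i → eval 2 (c (fsuc i)) (t ∷ x) * x i)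
        ≈⟨ +-cong (*-congʳ (eval₂-∷ (c fzero) t x)) (∑-cong k (λ i → *-congʳ (eval₂-∷ (c (fsuc i)) t x))) ⟩
      (a₀ + t * a₁ + (t * t) * a₂) * t + ∑ k (λ i → (e₀ i + t * e₁ i + (t * t) * e₂ i) * x i)
        ≈⟨ +-congˡ (∑-cong k (λ i → distribute (e₀ i) (e₁ i) (e₂ i) t (x i))) ⟩
      (a₀ + t * a₁ + (t * t) * a₂) * t + ∑ k (λ i → e₀ i * x i + t * (e₁ i * x i) + (t * t) * (e₂ i * x i))
        ≈⟨ +-congˡ (trans (∑-+ k _ _) (+-cong (∑-+-*ˡ k _ _ t) (∑-*ˡ k (t * t) _))) ⟩
      (a₀ + t * a₁ + (t * t) * a₂) * t
        + (∑ k (λ i → e₀ i * x i) + t * ∑ k (λ i → e₁ i * x i) + (t * t) * ∑ k (λ i → e₂ i * x i))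
        ≈⟨ +-congˡ (+-cong (+-cong (eval-suc 2 (C₀ c) x) (*-congˡ (eval-suc 1 (λ i → Q₁ (c (fsuc i))) x)))
                           (*-congˡ (eval-suc 0 (λ i → Q₂ (c (fsuc i))) x))) ⟨
      (a₀ + t * a₁ + (t * t) * a₂) * t + (b₀ + t * b₁ + (t * t) * b₂)
        ≈⟨ regroup a₀ a₁ a₂ b₀ b₁ b₂ t ⟩
      b₀ + t * (a₀ + b₁) + (t * t) * (a₁ + b₂) + (t * t * t) * a₂
        ≈⟨ +-congʳ (+-cong (+-congˡ (*-congˡ (eval-addᶠ 2 (Q₀ (c fzero)) _ x)))
                           (*-congˡ (eval-addᶠ 1 (Q₁ (c fzero)) _ x))) ⟨
      eval 3 (C₀ c) x + t * eval 2 (C₁ c) x + (t * t) * eval 1 (C₂ c) x + (t * t * t) * C₃ c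
        ∎
    where
    a₀ a₁ a₂ b₀ b₁ b₂ : R
    e₀ e₁ e₂ : Vector R k
    a₀ = eval 2 (Q₀ (c fzero)) x
    a₁ = eval 1 (Q₁ (c fzero)) x
    a₂ = Q₂ (c fzero)
    e₀ i = eval 2 (Q₀ (c (fsuc i))) x
    e₁ i = eval 1 (Q₁ (c (fsuc i))) x
    e₂ i = Q₂ (c (fsuc i))
    b₀ = eval 3 (C₀ c) x
    b₁ = eval 2 (λ i → Q₁ (c (fsuc i))) x
    b₂ = eval 1 (λ i → Q₂ (c (fsuc i))) x
    distribute : ∀ a b c t x → (a + t * b + (t * t) * c) * x ≈ a * x + t * (b * x) + (t * t) * (c * x)
    distribute = solve 5 (λ a b c t x → (a :+ t :* b :+ (t :* t) :* c) :* x
                                     := a :* x :+ t :* (b :* x) :+ (t :* t) :* (c :* x)) refl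
    regroup : ∀ a₀ a₁ a₂ b₀ b₁ b₂ t → (a₀ + t * a₁ + (t * t) * a₂) * t + (b₀ + t * b₁ + (t * t) * b₂)
                                    ≈ b₀ + t * (a₀ + b₁) + (t * t) * (a₁ + b₂) + (t * t * t) * a₂
    regroup = solve 7 (λ a₀ a₁ a₂ b₀ b₁ b₂ t →
                         (a₀ :+ t :* a₁ :+ (t :* t) :* a₂) :* t :+ (b₀ :+ t :* b₁ :+ (t :* t) :* b₂)
                         := b₀ :+ t :* (a₀ :+ b₁) :+ (t :* t) :* (a₁ :+ b₂) :+ (t :* t :* t) :* a₂) refl

  #monomials₂ : ℕ → ℕ
  #monomials₂ zero    = zero
  #monomials₂ (suc k) = #monomials₂ k ℕ.+ (k ℕ.+ 1)

  #monomials₃ : ℕ → ℕ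
  #monomials₃ zero    = zero
  #monomials₃ (suc k) = #monomials₃ k ℕ.+ (#monomials₂ k ℕ.+ (k ℕ.+ 1))

  -- The coefficients of the monomials x_i x_j with i ≤ j, collected by the first variable.
  coeffs₂ : ∀ k → Form 2 k → Vector R (#monomials₂ k)
  coeffs₂ zero    q ()
  coeffs₂ (suc k) q = coeffs₂ k (Q₀ q) ++ (Q₁ q ++ (λ (_ : Fin 1) → Q₂ q))

  coeffs₃ : ∀ k → Form 3 k → Vector R (#monomials₃ k)
  coeffs₃ zero    c ()
  coeffs₃ (suc k) c = coeffs₃ k (C₀ c) ++ (coeffs₂ k (C₁ c) ++ (C₂ c ++ (λ (_ : Fin 1) → C₃ c)))

  module _ {I : Set} (L : LinearFunctional I) where
    open LinearFunctionalProperties L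

    Λ-eval₁-0 : ∀ {k} (V : I → Form 1 k) → (∀ ι → Λ (λ v → V v ι) ≈ 0#) →
                ∀ x → Λ (λ v → eval 1 (V v) x) ≈ 0#
    Λ-eval₁-0 {k} V ΛV≈0 x = begin
        Λ (λ v → ∑ k (λ i → V v i * x i))  ≈⟨ Λ-∑ k (λ v i → V v i * x i) ⟩
        ∑ k (λ i → Λ (λ v → V v i * x i))  ≈⟨ ∑-0 k (λ i → trans (Λ-*ʳ (λ v → V v i) (x i)) (term≈0 i)) ⟩
        0#                                 ∎
      where term≈0 : ∀ i → Λ (λ v → V v i) * x i ≈ 0#
            term≈0 i = trans (*-congʳ (ΛV≈0 i)) (zeroˡ (x i))

    Λ-eval₂-0 : ∀ k (V : I → Form 2 k) → (∀ ι → Λ (λ v → coeffs₂ k (V v) ι) ≈ 0#) →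
                ∀ x → Λ (λ v → eval 2 (V v) x) ≈ 0#
    Λ-eval₂-0 zero    V _ x = Λ-0
    Λ-eval₂-0 (suc k) V ΛV≈0 x = begin
        Λ (λ v → eval 2 (V v) x)                  ≈⟨ Λ-cong (λ v → eval-congʳ 2 (V v) (∷-head-tail x)) ⟩
        Λ (λ v → eval 2 (V v) (head x ∷ tail x))  ≈⟨ Λ-cong (λ v → eval₂-∷ (V v) (head x) (tail x)) ⟩
        Λ (λ v → eval 2 (Q₀ (V v)) (tail x) + head x * eval 1 (Q₁ (V v)) (tail x) + (head x * head x) * Q₂ (V v))
          ≈⟨ Λ-+-*ˡ-0 (head x * head x)
               (Λ-+-*ˡ-0 (head x) (Λ-eval₂-0 k (λ v → Q₀ (V v)) ΛQ₀≈0 (tail x))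
                                  (Λ-eval₁-0 (λ v → Q₁ (V v)) ΛQ₁≈0 (tail x)))
               (ΛQ₂≈0 fzero) ⟩
        0#                                        ∎
      where
      Q₀s Q₁Q₂s : I → Vector R _
      Q₀s v = coeffs₂ k (Q₀ (V v))
      Q₁Q₂s v = Q₁ (V v) ++ (λ (_ : Fin 1) → Q₂ (V v))
      ΛQ₀≈0 : ∀ ι → Λ (λ v → Q₀s v ι) ≈ 0#
      ΛQ₀≈0 = Λ-++ˡ-0 Q₀s Q₁Q₂s ΛV≈0
      ΛQ₁≈0 : ∀ ι → Λ (λ v → Q₁ (V v) ι) ≈ 0#
      ΛQ₁≈0 = Λ-++ˡ-0 (λ v → Q₁ (V v)) _ (Λ-++ʳ-0 Q₀s Q₁Q₂s ΛV≈0)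
      ΛQ₂≈0 : ∀ ι → Λ (λ v → Q₂ (V v)) ≈ 0#
      ΛQ₂≈0 = Λ-++ʳ-0 (λ v → Q₁ (V v)) (λ v _ → Q₂ (V v)) (Λ-++ʳ-0 Q₀s Q₁Q₂s ΛV≈0)

    Λ-eval₃-0 : ∀ k (V : I → Form 3 k) → (∀ ι → Λ (λ v → coeffs₃ k (V v) ι) ≈ 0#) →
                ∀ x → Λ (λ v → eval 3 (V v) x) ≈ 0#
    Λ-eval₃-0 zero    V _ x = Λ-0
    Λ-eval₃-0 (suc k) V ΛV≈0 x = begin
        Λ (λ v → eval 3 (V v) x)                  ≈⟨ Λ-cong (λ v → eval-congʳ 3 (V v) (∷-head-tail x)) ⟩
        Λ (λ v → eval 3 (V v) (head x ∷ tail x))  ≈⟨ Λ-cong (λ v → eval₃-∷ (V v) t (tail x)) ⟩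
        Λ (λ v → eval 3 (C₀ (V v)) (tail x) + t * eval 2 (C₁ (V v)) (tail x)
                 + (t * t) * eval 1 (C₂ (V v)) (tail x) + (t * t * t) * C₃ (V v))
          ≈⟨ Λ-+-*ˡ-0 (t * t * t)
               (Λ-+-*ˡ-0 (t * t)
                 (Λ-+-*ˡ-0 t (Λ-eval₃-0 k (λ v → C₀ (V v)) ΛC₀≈0 (tail x))
                             (Λ-eval₂-0 k (λ v → C₁ (V v)) ΛC₁≈0 (tail x)))
                 (Λ-eval₁-0 (λ v → C₂ (V v)) ΛC₂≈0 (tail x)))
               (ΛC₃≈0 fzero) ⟩
        0#                                        ∎
      where
      t : R
      t = head x
      C₀s C₁s C₂C₃s C₁C₂C₃s : I → Vector R _
      C₀s v = coeffs₃ k (C₀ (V v))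
      C₁s v = coeffs₂ k (C₁ (V v))
      C₂C₃s v = C₂ (V v) ++ (λ (_ : Fin 1) → C₃ (V v))
      C₁C₂C₃s v = C₁s v ++ C₂C₃s v
      ΛC₁C₂C₃≈0 : ∀ ι → Λ (λ v → C₁C₂C₃s v ι) ≈ 0#
      ΛC₁C₂C₃≈0 = Λ-++ʳ-0 C₀s C₁C₂C₃s ΛV≈0
      ΛC₂C₃≈0 : ∀ ι → Λ (λ v → C₂C₃s v ι) ≈ 0#
      ΛC₂C₃≈0 = Λ-++ʳ-0 C₁s C₂C₃s ΛC₁C₂C₃≈0
      ΛC₀≈0 : ∀ ι → Λ (λ v → C₀s v ι) ≈ 0#
      ΛC₀≈0 = Λ-++ˡ-0 C₀s C₁C₂C₃s ΛV≈0
      ΛC₁≈0 : ∀ ι → Λ (λ v → C₁s v ι) ≈ 0#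
      ΛC₁≈0 = Λ-++ˡ-0 C₁s C₂C₃s ΛC₁C₂C₃≈0
      ΛC₂≈0 : ∀ ι → Λ (λ v → C₂ (V v) ι) ≈ 0#
      ΛC₂≈0 = Λ-++ˡ-0 (λ v → C₂ (V v)) _ ΛC₂C₃≈0
      ΛC₃≈0 : ∀ ι → Λ (λ v → C₃ (V v)) ≈ 0#
      ΛC₃≈0 = Λ-++ʳ-0 (λ v → C₂ (V v)) (λ v _ → C₃ (V v)) ΛC₂C₃≈0

  lincomb : ∀ {n k} → (Fin k → Vector R n) → Vector R k → Vector R n
  lincomb {n} {k} S x i = ∑ k (λ j → x j * S j i)

  record IsLinear {n} (g : Vector R n → R) : Set where
    field
      g-cong : ∀ {u u' : Vector R n} → (∀ i → u i ≈ u' i) → g u ≈ g u'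
      g-+    : ∀ (u u' : Vector R n) → g (λ i → u i + u' i) ≈ g u + g u'
      g-*    : ∀ c (u : Vector R n) → g (λ i → c * u i) ≈ c * g u

  module _ {n : ℕ} {g : Vector R n → R} (lin : IsLinear g) where
    open IsLinear lin

    linear-lincomb : ∀ {k} (S : Fin k → Vector R n) x → g (lincomb S x) ≈ eval 1 (λ b → g (S b)) x
    linear-lincomb {k} S x = trans (expand k S x) (∑-cong k (λ a → *-comm (x a) (g (S a))))
      where
      expand : ∀ k (S : Fin k → Vector R n) x → g (lincomb S x) ≈ ∑ k (λ a → x a * g (S a))
      expand zero S x = begin
          g (λ _ → 0#)        ≈⟨ g-cong (λ _ → sym (zeroˡ 0#)) ⟩
          g (λ _ → 0# * 0#)   ≈⟨ g-* 0# (λ _ → 0#) ⟩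
          0# * g (λ _ → 0#)   ≈⟨ zeroˡ _ ⟩
          0#                  ∎
      expand (suc k) S x = begin
          g (λ i → x fzero * S fzero i + lincomb (tail S) (tail x) i)
            ≈⟨ g-+ _ _ ⟩
          g (λ i → x fzero * S fzero i) + g (lincomb (tail S) (tail x))
            ≈⟨ +-cong (g-* (x fzero) (S fzero)) (expand k (tail S) (tail x)) ⟩
          x fzero * g (S fzero) + ∑ k (λ a → x (fsuc a) * g (S (fsuc a)))
            ∎

  bilinear-lincomb : ∀ {n} (g : Vector R n → Vector R n → R) →
                     (∀ v → IsLinear (λ u → g u v)) → (∀ u → IsLinear (λ v → g u v)) →
                     ∀ {k} (S : Fin k → Vector R n) x → g (lincomb S x) (lincomb S x) ≈ eval 2 (λ b c → g (S b) (S c)) x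
  bilinear-lincomb g lin₁ lin₂ {k} S x = begin
      g L L                                             ≈⟨ linear-lincomb (lin₁ L) S x ⟩
      ∑ k (λ b → g (S b) L * x b)                       ≈⟨ ∑-cong k (λ b → *-congʳ (linear-lincomb (lin₂ (S b)) S x)) ⟩
      ∑ k (λ b → eval 1 (λ c → g (S b) (S c)) x * x b)  ≈⟨ eval-suc 1 (λ b c → g (S b) (S c)) x ⟨
      eval 2 (λ b c → g (S b) (S c)) x                  ∎
    where L : Vector R _
          L = lincomb S x

  trilinear-lincomb : ∀ {n} (g : Vector R n → Vector R n → Vector R n → R) →
                      (∀ v w → IsLinear (λ u → g u v w)) → (∀ u w → IsLinear (λ v → g u v w)) →
                      (∀ u v → IsLinear (λ w → g u v w)) →
                      ∀ {k} (S : Fin k → Vector R n) x →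
                      g (lincomb S x) (lincomb S x) (lincomb S x) ≈ eval 3 (λ b c d → g (S b) (S c) (S d)) x
  trilinear-lincomb g lin₁ lin₂ lin₃ {k} S x = begin
      g L L L
        ≈⟨ linear-lincomb (lin₁ L L) S x ⟩
      ∑ k (λ b → g (S b) L L * x b)
        ≈⟨ ∑-cong k (λ b → *-congʳ (bilinear-lincomb (g (S b)) (lin₂ (S b)) (lin₃ (S b)) S x)) ⟩
      ∑ k (λ b → eval 2 (λ c d → g (S b) (S c) (S d)) x * x b)
        ≈⟨ eval-suc 2 (λ b c d → g (S b) (S c) (S d)) x ⟨
      eval 3 (λ b c d → g (S b) (S c) (S d)) x
        ∎
    where L : Vector R _
          L = lincomb S x

  unit : ∀ {n} → Fin n → Vector R n
  unit fzero    fzero    = 1#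
  unit fzero    (fsuc _) = 0#
  unit (fsuc _) fzero    = 0#
  unit (fsuc i) (fsuc j) = unit i j

  lincomb-unit : ∀ n (e : Vector R n) j → lincomb unit e j ≈ e j
  lincomb-unit (suc n) e fzero = begin
      e fzero * 1# + ∑ n (λ i → e (fsuc i) * 0#)  ≈⟨ +-cong (*-identityʳ _) (∑-0 n (λ i → zeroʳ _)) ⟩
      e fzero + 0#                                ≈⟨ +-identityʳ _ ⟩
      e fzero                                     ∎
  lincomb-unit (suc n) e (fsuc j) = begin
      e fzero * 0# + ∑ n (λ i → e (fsuc i) * unit i j)  ≈⟨ +-cong (zeroʳ _) (lincomb-unit n (tail e) j) ⟩
      0# + e (fsuc j)                                   ≈⟨ +-identityˡ _ ⟩
      e (fsuc j)                                        ∎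

  linear-+-* : ∀ {n} {g : Vector R n → R} → IsLinear g → ∀ u e t → g (λ i → u i + t * e i) ≈ g u + t * g e
  linear-+-* lin u e t = trans (IsLinear.g-+ lin u _) (+-congˡ (IsLinear.g-* lin t e))

  module _ {n : ℕ} where

    linear-coords : ∀ {g : Vector R n → R} → IsLinear g → ∀ e → g e ≈ eval 1 (λ i → g (unit i)) e
    linear-coords lin e = trans (IsLinear.g-cong lin (λ j → sym (lincomb-unit n e j))) (linear-lincomb lin unit e)

    bilinear-coords : ∀ (g : Vector R n → Vector R n → R) →
                      (∀ v → IsLinear (λ u → g u v)) → (∀ u → IsLinear (λ v → g u v)) →
                      ∀ e → g e e ≈ eval 2 (λ i j → g (unit i) (unit j)) e
    bilinear-coords g lin₁ lin₂ e =
      trans (trans (IsLinear.g-cong (lin₁ e) e≈L) (IsLinear.g-cong (lin₂ L) e≈L)) (bilinear-lincomb g lin₁ lin₂ unit e)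
      where L : Vector R n
            L = lincomb unit e
            e≈L : ∀ j → e j ≈ L j
            e≈L j = sym (lincomb-unit n e j)

    trilinear-coords : ∀ (g : Vector R n → Vector R n → Vector R n → R) →
                       (∀ v w → IsLinear (λ u → g u v w)) → (∀ u w → IsLinear (λ v → g u v w)) →
                       (∀ u v → IsLinear (λ w → g u v w)) →
                       ∀ e → g e e e ≈ eval 3 (λ i j l → g (unit i) (unit j) (unit l)) e
    trilinear-coords g lin₁ lin₂ lin₃ e =
      trans (trans (IsLinear.g-cong (lin₁ e e) e≈L) (trans (IsLinear.g-cong (lin₂ L e) e≈L) (IsLinear.g-cong (lin₃ L L) e≈L)))
            (trilinear-lincomb g lin₁ lin₂ lin₃ unit e)
      where L : Vector R n
            L = lincomb unit e
            e≈L : ∀ j → e j ≈ L j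
            e≈L j = sym (lincomb-unit n e j)

  eval-addᶠ₄ : ∀ d {k} (a b c f : Form d k) y →
               eval d a y + eval d b y + eval d c y + eval d f y ≈ eval d (addᶠ d (addᶠ d (addᶠ d a b) c) f) y
  eval-addᶠ₄ d a b c f y = sym (trans (eval-addᶠ d _ f y) (+-congʳ (trans (eval-addᶠ d _ c y) (+-congʳ (eval-addᶠ d a b y)))))

  eval-addᶠ₆ : ∀ d {k} (a b c f g h : Form d k) y →
               eval d a y + eval d b y + eval d c y + eval d f y + eval d g y + eval d h y
               ≈ eval d (addᶠ d (addᶠ d (addᶠ d (addᶠ d (addᶠ d a b) c) f) g) h) y
  eval-addᶠ₆ d a b c f g h y =
    sym (trans (eval-addᶠ d _ h y) (+-congʳ (trans (eval-addᶠ d _ g y) (+-congʳ (sym (eval-addᶠ₄ d a b c f y))))))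

  evaluation₁ : ∀ {n} → Vector R n → LinearFunctional (Fin n)
  evaluation₁ e = record
    { Λ = λ f → eval 1 f e
    ; Λ-cong = eval-congˡ 1 e
    ; Λ-+ = λ f g → eval-addᶠ 1 f g e
    ; Λ-*ʳ = λ f s → eval-scaleᶠ 1 f s e }

  evaluation₂ : ∀ {n} → Vector R n → LinearFunctional (Fin n × Fin n)
  evaluation₂ e = record
    { Λ = λ f → eval 2 (λ i j → f (i , j)) e
    ; Λ-cong = λ f≈g → eval-congˡ 2 e (λ i j → f≈g (i , j))
    ; Λ-+ = λ f g → eval-addᶠ 2 _ _ e
    ; Λ-*ʳ = λ f s → eval-scaleᶠ 2 _ s e }

  module Quartic {n : ℕ} (F : Form 4 n) where

    ∑⁴ : (Fin n → Fin n → Fin n → Fin n → R) → R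
    ∑⁴ f = ∑ n (λ i → ∑ n (λ j → ∑ n (λ l → ∑ n (λ m → f i j l m))))

    ∑⁴-cong : ∀ {f g} → (∀ i j l m → f i j l m ≈ g i j l m) → ∑⁴ f ≈ ∑⁴ g
    ∑⁴-cong f≈g = ∑-cong n (λ i → ∑-cong n (λ j → ∑-cong n (λ l → ∑-cong n (λ m → f≈g i j l m))))

    ∑⁴-+ : ∀ f g → ∑⁴ (λ i j l m → f i j l m + g i j l m) ≈ ∑⁴ f + ∑⁴ g
    ∑⁴-+ f g = trans (∑-cong n (λ i → trans (∑-cong n (λ j → trans (∑-cong n (λ l → ∑-+ n _ _)) (∑-+ n _ _)))
                                            (∑-+ n _ _)))
                     (∑-+ n _ _)

    ∑⁴-*ˡ : ∀ c f → ∑⁴ (λ i j l m → c * f i j l m) ≈ c * ∑⁴ f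
    ∑⁴-*ˡ c f = trans (∑-cong n (λ i → trans (∑-cong n (λ j → trans (∑-cong n (λ l → ∑-*ˡ n c _)) (∑-*ˡ n c _)))
                                             (∑-*ˡ n c _)))
                      (∑-*ˡ n c _)

    -- Φ y y y y is eval 4 F y by definition.
    Φ : Vector R n → Vector R n → Vector R n → Vector R n → R
    Φ u v w z = ∑⁴ (λ i j l m → F i j l m * u i * v j * w l * z m)

    Φ-linear₁ : ∀ v w z → IsLinear (λ u → Φ u v w z)
    Φ-linear₁ v w z = record
      { g-cong = λ u≈u' → ∑⁴-cong (λ i j l m → *-congʳ (*-congʳ (*-congʳ (*-congˡ (u≈u' i)))))
      ; g-+ = λ u u' → trans (∑⁴-cong (λ i j l m → split (F i j l m) (u i) (u' i) (v j) (w l) (z m))) (∑⁴-+ _ _)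
      ; g-* = λ c u → trans (∑⁴-cong (λ i j l m → pull (F i j l m) c (u i) (v j) (w l) (z m))) (∑⁴-*ˡ c _) }
      where
      split : ∀ f a a' v w z → f * (a + a') * v * w * z ≈ f * a * v * w * z + f * a' * v * w * z
      split = solve 6 (λ f a a' v w z → f :* (a :+ a') :* v :* w :* z := f :* a :* v :* w :* z :+ f :* a' :* v :* w :* z) refl
      pull : ∀ f c a v w z → f * (c * a) * v * w * z ≈ c * (f * a * v * w * z)
      pull = solve 6 (λ f c a v w z → f :* (c :* a) :* v :* w :* z := c :* (f :* a :* v :* w :* z)) refl

    Φ-linear₂ : ∀ u w z → IsLinear (λ v → Φ u v w z)
    Φ-linear₂ u w z = record
      { g-cong = λ v≈v' → ∑⁴-cong (λ i j l m → *-congʳ (*-congʳ (*-congˡ (v≈v' j))))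
      ; g-+ = λ v v' → trans (∑⁴-cong (λ i j l m → split (F i j l m) (u i) (v j) (v' j) (w l) (z m))) (∑⁴-+ _ _)
      ; g-* = λ c v → trans (∑⁴-cong (λ i j l m → pull (F i j l m) (u i) c (v j) (w l) (z m))) (∑⁴-*ˡ c _) }
      where
      split : ∀ f u a a' w z → f * u * (a + a') * w * z ≈ f * u * a * w * z + f * u * a' * w * z
      split = solve 6 (λ f u a a' w z → f :* u :* (a :+ a') :* w :* z := f :* u :* a :* w :* z :+ f :* u :* a' :* w :* z) refl
      pull : ∀ f u c a w z → f * u * (c * a) * w * z ≈ c * (f * u * a * w * z)
      pull = solve 6 (λ f u c a w z → f :* u :* (c :* a) :* w :* z := c :* (f :* u :* a :* w :* z)) refl

    Φ-linear₃ : ∀ u v z → IsLinear (λ w → Φ u v w z)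
    Φ-linear₃ u v z = record
      { g-cong = λ w≈w' → ∑⁴-cong (λ i j l m → *-congʳ (*-congˡ (w≈w' l)))
      ; g-+ = λ w w' → trans (∑⁴-cong (λ i j l m → split (F i j l m) (u i) (v j) (w l) (w' l) (z m))) (∑⁴-+ _ _)
      ; g-* = λ c w → trans (∑⁴-cong (λ i j l m → pull (F i j l m) (u i) (v j) c (w l) (z m))) (∑⁴-*ˡ c _) }
      where
      split : ∀ f u v a a' z → f * u * v * (a + a') * z ≈ f * u * v * a * z + f * u * v * a' * z
      split = solve 6 (λ f u v a a' z → f :* u :* v :* (a :+ a') :* z := f :* u :* v :* a :* z :+ f :* u :* v :* a' :* z) refl
      pull : ∀ f u v c a z → f * u * v * (c * a) * z ≈ c * (f * u * v * a * z)
      pull = solve 6 (λ f u v c a z → f :* u :* v :* (c :* a) :* z := c :* (f :* u :* v :* a :* z)) refl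

    Φ-linear₄ : ∀ u v w → IsLinear (λ z → Φ u v w z)
    Φ-linear₄ u v w = record
      { g-cong = λ z≈z' → ∑⁴-cong (λ i j l m → *-congˡ (z≈z' m))
      ; g-+ = λ z z' → trans (∑⁴-cong (λ i j l m → split (F i j l m) (u i) (v j) (w l) (z m) (z' m))) (∑⁴-+ _ _)
      ; g-* = λ c z → trans (∑⁴-cong (λ i j l m → pull (F i j l m) (u i) (v j) (w l) c (z m))) (∑⁴-*ˡ c _) }
      where
      split : ∀ f u v w a a' → f * u * v * w * (a + a') ≈ f * u * v * w * a + f * u * v * w * a'
      split = solve 6 (λ f u v w a a' → f :* u :* v :* w :* (a :+ a') := f :* u :* v :* w :* a :+ f :* u :* v :* w :* a') refl
      pull : ∀ f u v w c a → f * u * v * w * (c * a) ≈ c * (f * u * v * w * a)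
      pull = solve 6 (λ f u v w c a → f :* u :* v :* w :* (c :* a) := c :* (f :* u :* v :* w :* a)) refl

    cross₁ cross₂ cross₃ : Vector R n → Vector R n → R
    cross₁ u e = Φ e u u u + Φ u e u u + Φ u u e u + Φ u u u e
    cross₂ u e = Φ u u e e + Φ u e u e + Φ u e e u + Φ e u u e + Φ e u e u + Φ e e u u
    cross₃ u e = Φ u e e e + Φ e u e e + Φ e e u e + Φ e e e u

    Φ-expand : ∀ u e t → let p = λ i → u i + t * e i in
               Φ p p p p ≈ Φ u u u u + t * cross₁ u e + (t * t) * cross₂ u e + (t * t * t) * cross₃ u e
                           + Φ e e e e * (t * t * t * t)
    Φ-expand u e t = trans expand₁ regroup
      where
      p : Vector R n
      p i = u i + t * e i
      E₄ : Vector R n → Vector R n → Vector R n → R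
      E₄ a b c = Φ a b c u + t * Φ a b c e
      E₃ : Vector R n → Vector R n → R
      E₃ a b = E₄ a b u + t * E₄ a b e
      E₂ : Vector R n → R
      E₂ a = E₃ a u + t * E₃ a e
      expand₄ : ∀ a b c → Φ a b c p ≈ E₄ a b c
      expand₄ a b c = linear-+-* (Φ-linear₄ a b c) u e t
      expand₃ : ∀ a b → Φ a b p p ≈ E₃ a b
      expand₃ a b = trans (linear-+-* (Φ-linear₃ a b p) u e t) (+-cong (expand₄ a b u) (*-congˡ (expand₄ a b e)))
      expand₂ : ∀ a → Φ a p p p ≈ E₂ a
      expand₂ a = trans (linear-+-* (Φ-linear₂ a p p) u e t) (+-cong (expand₃ a u) (*-congˡ (expand₃ a e)))
      expand₁ : Φ p p p p ≈ E₂ u + t * E₂ e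
      expand₁ = trans (linear-+-* (Φ-linear₁ p p p) u e t) (+-cong (expand₂ u) (*-congˡ (expand₂ e)))
      regroup : E₂ u + t * E₂ e ≈ Φ u u u u + t * cross₁ u e + (t * t) * cross₂ u e + (t * t * t) * cross₃ u e
                                  + Φ e e e e * (t * t * t * t)
      regroup = lemma (Φ u u u u) (Φ u u u e) (Φ u u e u) (Φ u u e e) (Φ u e u u) (Φ u e u e) (Φ u e e u) (Φ u e e e)
                      (Φ e u u u) (Φ e u u e) (Φ e u e u) (Φ e u e e) (Φ e e u u) (Φ e e u e) (Φ e e e u) (Φ e e e e) t
        where
        lemma : ∀ uuuu uuue uueu uuee ueuu ueue ueeu ueee euuu euue eueu euee eeuu eeue eeeu eeee t →
          ((uuuu + t * uuue) + t * (uueu + t * uuee)) + t * ((ueuu + t * ueue) + t * (ueeu + t * ueee))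
          + t * (((euuu + t * euue) + t * (eueu + t * euee)) + t * ((eeuu + t * eeue) + t * (eeeu + t * eeee)))
          ≈ uuuu + t * (euuu + ueuu + uueu + uuue) + (t * t) * (uuee + ueue + ueeu + euue + eueu + eeuu)
            + (t * t * t) * (ueee + euee + eeue + eeeu) + eeee * (t * t * t * t)
        lemma = solve 17 (λ uuuu uuue uueu uuee ueuu ueue ueeu ueee euuu euue eueu euee eeuu eeue eeeu eeee t →
          ((uuuu :+ t :* uuue) :+ t :* (uueu :+ t :* uuee)) :+ t :* ((ueuu :+ t :* ueue) :+ t :* (ueeu :+ t :* ueee))
          :+ t :* (((euuu :+ t :* euue) :+ t :* (eueu :+ t :* euee)) :+ t :* ((eeuu :+ t :* eeue) :+ t :* (eeeu :+ t :* eeee)))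
          := uuuu :+ t :* (euuu :+ ueuu :+ uueu :+ uuue) :+ (t :* t) :* (uuee :+ ueue :+ ueeu :+ euue :+ eueu :+ eeuu)
            :+ (t :* t :* t) :* (ueee :+ euee :+ eeue :+ eeeu) :+ eeee :* (t :* t :* t :* t)) refl

    -- For u = lincomb S x, cross_r u e has degree 4 - r in x and r in e. The conditions are its
    -- coefficients per monomial in x, as forms in e; the parts are its coefficients per
    -- monomial in e, as forms in x.
    module _ {k : ℕ} (S : Fin k → Vector R n) where

      cubicConditions : Fin k → Form 3 n
      cubicConditions a j l m =
        Φ (S a) (unit j) (unit l) (unit m) + Φ (unit j) (S a) (unit l) (unit m)
        + Φ (unit j) (unit l) (S a) (unit m) + Φ (unit j) (unit l) (unit m) (S a)

      quadraticPart : Fin n × Fin n → Form 2 k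
      quadraticPart (i , j) b c =
        Φ (S b) (S c) (unit i) (unit j) + Φ (S b) (unit i) (S c) (unit j) + Φ (S b) (unit i) (unit j) (S c)
        + Φ (unit i) (S b) (S c) (unit j) + Φ (unit i) (S b) (unit j) (S c) + Φ (unit i) (unit j) (S b) (S c)

      linearPart : Fin n → Form 3 k
      linearPart i b c d =
        Φ (unit i) (S b) (S c) (S d) + Φ (S b) (unit i) (S c) (S d)
        + Φ (S b) (S c) (unit i) (S d) + Φ (S b) (S c) (S d) (unit i)

      quadraticConditions : Fin (#monomials₂ k) → Form 2 n
      quadraticConditions ι i j = coeffs₂ k (quadraticPart (i , j)) ι

      linearConditions : Fin (#monomials₃ k) → Form 1 n
      linearConditions ι i = coeffs₃ k (linearPart i) ι

      module _ (e : Vector R n) (x : Vector R k) where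

        private
          u : Vector R n
          u = lincomb S x

        cross₃-0 : (∀ a → eval 3 (cubicConditions a) e ≈ 0#) → cross₃ u e ≈ 0#
        cross₃-0 cubic≈0 = begin
            cross₃ u e
              ≈⟨ +-cong (+-cong (+-cong (linear-lincomb (Φ-linear₁ e e e) S x) (linear-lincomb (Φ-linear₂ e e e) S x))
                                (linear-lincomb (Φ-linear₃ e e e) S x))
                        (linear-lincomb (Φ-linear₄ e e e) S x) ⟩
            eval 1 (λ a → Φ (S a) e e e) x + eval 1 (λ a → Φ e (S a) e e) x
            + eval 1 (λ a → Φ e e (S a) e) x + eval 1 (λ a → Φ e e e (S a)) x
              ≈⟨ eval-addᶠ₄ 1 _ _ _ _ x ⟩
            eval 1 (λ a → cross₃ (S a) e) x
              ≈⟨ eval₁-0 _ x (λ a → trans (in-coords a) (cubic≈0 a)) ⟩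
            0#
              ∎
          where
          in-coords : ∀ a → cross₃ (S a) e ≈ eval 3 (cubicConditions a) e
          in-coords a = trans
            (+-cong (+-cong (+-cong
              (trilinear-coords (λ v₁ v₂ v₃ → Φ A v₁ v₂ v₃) (Φ-linear₂ A) (Φ-linear₃ A) (Φ-linear₄ A) e)
              (trilinear-coords (λ v₁ v₂ v₃ → Φ v₁ A v₂ v₃) (λ v w → Φ-linear₁ A v w) (λ v w → Φ-linear₃ v A w)
                                (λ v w → Φ-linear₄ v A w) e))
              (trilinear-coords (λ v₁ v₂ v₃ → Φ v₁ v₂ A v₃) (λ v w → Φ-linear₁ v A w) (λ v w → Φ-linear₂ v A w)
                                (λ v w → Φ-linear₄ v w A) e))
              (trilinear-coords (λ v₁ v₂ v₃ → Φ v₁ v₂ v₃ A) (λ v w → Φ-linear₁ v w A) (λ v w → Φ-linear₂ v w A)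
                                (λ v w → Φ-linear₃ v w A) e))
            (eval-addᶠ₄ 3 _ _ _ _ e)
            where A : Vector R n
                  A = S a

        cross₂-0 : (∀ ι → eval 2 (quadraticConditions ι) e ≈ 0#) → cross₂ u e ≈ 0#
        cross₂-0 quadratic≈0 = begin
            cross₂ u e
              ≈⟨ +-cong (+-cong (+-cong (+-cong (+-cong
                   (bilinear-lincomb (λ v₁ v₂ → Φ v₁ v₂ e e) (λ v → Φ-linear₁ v e e) (λ w → Φ-linear₂ w e e) S x)
                   (bilinear-lincomb (λ v₁ v₂ → Φ v₁ e v₂ e) (λ v → Φ-linear₁ e v e) (λ w → Φ-linear₃ w e e) S x))
                   (bilinear-lincomb (λ v₁ v₂ → Φ v₁ e e v₂) (λ v → Φ-linear₁ e e v) (λ w → Φ-linear₄ w e e) S x))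
                   (bilinear-lincomb (λ v₁ v₂ → Φ e v₁ v₂ e) (λ v → Φ-linear₂ e v e) (λ w → Φ-linear₃ e w e) S x))
                   (bilinear-lincomb (λ v₁ v₂ → Φ e v₁ e v₂) (λ v → Φ-linear₂ e e v) (λ w → Φ-linear₄ e w e) S x))
                   (bilinear-lincomb (λ v₁ v₂ → Φ e e v₁ v₂) (λ v → Φ-linear₃ e e v) (λ w → Φ-linear₄ e e w) S x) ⟩
            _
              ≈⟨ eval-addᶠ₆ 2 _ _ _ _ _ _ x ⟩
            eval 2 W x
              ≈⟨ eval-congˡ 2 x in-coords ⟩
            eval 2 (Λᶠ 2 quadraticPart) x
              ≈⟨ eval-Λᶠ 2 quadraticPart x ⟩
            Λ (λ p → eval 2 (quadraticPart p) x)
              ≈⟨ Λ-eval₂-0 (evaluation₂ e) k quadraticPart quadratic≈0 x ⟩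
            0#
              ∎
          where
          open LinearFunctionalProperties (evaluation₂ e)
          W : Form 2 k
          W b c = Φ (S b) (S c) e e + Φ (S b) e (S c) e + Φ (S b) e e (S c)
                  + Φ e (S b) (S c) e + Φ e (S b) e (S c) + Φ e e (S b) (S c)
          in-coords : ≈ᶠ 2 W (Λᶠ 2 quadraticPart)
          in-coords b c = trans
            (+-cong (+-cong (+-cong (+-cong (+-cong
              (bilinear-coords (λ w₁ w₂ → Φ B C w₁ w₂) (Φ-linear₃ B C) (Φ-linear₄ B C) e)
              (bilinear-coords (λ w₁ w₂ → Φ B w₁ C w₂) (λ v → Φ-linear₂ B C v) (λ w → Φ-linear₄ B w C) e))
              (bilinear-coords (λ w₁ w₂ → Φ B w₁ w₂ C) (λ v → Φ-linear₂ B v C) (λ w → Φ-linear₃ B w C) e))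
              (bilinear-coords (λ w₁ w₂ → Φ w₁ B C w₂) (λ v → Φ-linear₁ B C v) (λ w → Φ-linear₄ w B C) e))
              (bilinear-coords (λ w₁ w₂ → Φ w₁ B w₂ C) (λ v → Φ-linear₁ B v C) (λ w → Φ-linear₃ w B C) e))
              (bilinear-coords (λ w₁ w₂ → Φ w₁ w₂ B C) (λ v → Φ-linear₁ v B C) (λ w → Φ-linear₂ w B C) e))
            (eval-addᶠ₆ 2 _ _ _ _ _ _ e)
            where B C : Vector R n
                  B = S b ; C = S c

        cross₁-0 : (∀ ι → eval 1 (linearConditions ι) e ≈ 0#) → cross₁ u e ≈ 0#
        cross₁-0 linear≈0 = begin
            cross₁ u e
              ≈⟨ +-cong (+-cong (+-cong
                   (trilinear-lincomb (λ v₁ v₂ v₃ → Φ e v₁ v₂ v₃) (Φ-linear₂ e) (Φ-linear₃ e) (Φ-linear₄ e) S x)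
                   (trilinear-lincomb (λ v₁ v₂ v₃ → Φ v₁ e v₂ v₃) (Φ-linear₁ e) (λ v w → Φ-linear₃ v e w)
                                      (λ v w → Φ-linear₄ v e w) S x))
                   (trilinear-lincomb (λ v₁ v₂ v₃ → Φ v₁ v₂ e v₃) (λ v w → Φ-linear₁ v e w) (λ v w → Φ-linear₂ v e w)
                                      (λ v w → Φ-linear₄ v w e) S x))
                   (trilinear-lincomb (λ v₁ v₂ v₃ → Φ v₁ v₂ v₃ e) (λ v w → Φ-linear₁ v w e) (λ v w → Φ-linear₂ v w e)
                                      (λ v w → Φ-linear₃ v w e) S x) ⟩
            _
              ≈⟨ eval-addᶠ₄ 3 _ _ _ _ x ⟩
            eval 3 W x
              ≈⟨ eval-congˡ 3 x in-coords ⟩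
            eval 3 (Λᶠ 3 linearPart) x
              ≈⟨ eval-Λᶠ 3 linearPart x ⟩
            Λ (λ i → eval 3 (linearPart i) x)
              ≈⟨ Λ-eval₃-0 (evaluation₁ e) k linearPart linear≈0 x ⟩
            0#
              ∎
          where
          open LinearFunctionalProperties (evaluation₁ e)
          W : Form 3 k
          W b c d = Φ e (S b) (S c) (S d) + Φ (S b) e (S c) (S d) + Φ (S b) (S c) e (S d) + Φ (S b) (S c) (S d) e
          in-coords : ≈ᶠ 3 W (Λᶠ 3 linearPart)
          in-coords b c d = trans
            (+-cong (+-cong (+-cong
              (linear-coords (Φ-linear₁ (S b) (S c) (S d)) e)
              (linear-coords (Φ-linear₂ (S b) (S c) (S d)) e))
              (linear-coords (Φ-linear₃ (S b) (S c) (S d)) e))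
              (linear-coords (Φ-linear₄ (S b) (S c) (S d)) e))
            (eval-addᶠ₄ 1 _ _ _ _ e)

      orthogonal : ∀ e → (∀ a → eval 3 (cubicConditions a) e ≈ 0#) → (∀ ι → eval 2 (quadraticConditions ι) e ≈ 0#) →
                   (∀ ι → eval 1 (linearConditions ι) e ≈ 0#) →
                   ∀ x t → eval 4 F (λ i → lincomb S x i + t * e i) ≈ eval 4 F (lincomb S x) + eval 4 F e * (t * t * t * t)
      orthogonal e cubic≈0 quadratic≈0 linear≈0 x t = begin
          Φ p p p p
            ≈⟨ Φ-expand u e t ⟩
          Φ u u u u + t * cross₁ u e + (t * t) * cross₂ u e + (t * t * t) * cross₃ u e + Φ e e e e * (t * t * t * t)
            ≈⟨ +-congʳ (+-cong (+-cong (+-congˡ (*-congˡ (cross₁-0 e x linear≈0))) (*-congˡ (cross₂-0 e x quadratic≈0)))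
                               (*-congˡ (cross₃-0 e x cubic≈0))) ⟩
          Φ u u u u + t * 0# + (t * t) * 0# + (t * t * t) * 0# + Φ e e e e * (t * t * t * t)
            ≈⟨ drop-zeros (Φ u u u u) (Φ e e e e * (t * t * t * t)) t ⟩
          Φ u u u u + Φ e e e e * (t * t * t * t)
            ∎
        where
        u p : Vector R n
        u = lincomb S x
        p i = u i + t * e i
        drop-zeros : ∀ a b t → a + t * 0# + (t * t) * 0# + (t * t * t) * 0# + b ≈ a + b
        drop-zeros = solve 3 (λ a b t → a :+ t :* con 0 :+ (t :* t) :* con 0 :+ (t :* t :* t) :* con 0 :+ b := a :+ b) refl

open import Defs hiding (_+_; _*_)
open import Data.Nat using (ℕ; zero; suc; _<_; _*_; _+_; _/_)
open import Data.Nat.Properties using (≤⇒≯)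
open import Data.Nat.DivMod using (m*n/n≡m)
open import Data.Nat.Tactic.RingSolver using (solve-∀)
open import Data.Fin using (Fin) renaming (zero to fzero; suc to fsuc)
open import Data.Product using (Σ; _×_; _,_)
open import Data.Bool.Properties using () renaming (_≟_ to _≟ᵇ_)
open import Data.Empty using (⊥-elim)
open import Relation.Binary.PropositionalEquality using (_≡_; refl; trans; cong; cong₂; subst; subst₂)
open import Relation.Nullary using (¬_; yes; no)
open ℚ₂-Ring using (ℚ₂-commutativeRing; _≃_; mk≃; ≃⇒≈)
open CommutativeRing ℚ₂-commutativeRing using (+-cong; *-cong; setoid)
  renaming (refl to ≃-refl; reflexive to ≃-reflexive; trans to ≃-trans)
open import Relation.Binary.Reasoning.Setoid setoid

module ℚ₂Forms = Forms ℚ₂-commutativeRing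
open ℚ₂Forms using (#monomials₂; #monomials₃; eval; eval-congʳ)
open ℚ₂Forms.Quartic using (cubicConditions; quadraticConditions; linearConditions; orthogonal)

∑≡∑ : ∀ n {f g : Fin n → ℚ₂} → (∀ i → f i ≡ g i) → ∑ n f ≡ ℚ₂Forms.∑ n g
∑≡∑ zero    _   = refl
∑≡∑ (suc n) f≡g = cong₂ Defs._+_ (f≡g fzero) (∑≡∑ n (λ i → f≡g (fsuc i)))

evalL≡eval : ∀ {n} (c : LinearForm n) x → evalL c x ≡ eval 1 c x
evalL≡eval {n} c x = ∑≡∑ n (λ i → refl)

evalQ≡eval : ∀ {n} (c : QuadraticForm n) x → evalQ c x ≡ eval 2 c x
evalQ≡eval {n} c x = ∑≡∑ n (λ i → ∑≡∑ n (λ j → refl))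

evalC≡eval : ∀ {n} (c : CubicForm n) x → evalC c x ≡ eval 3 c x
evalC≡eval {n} c x = ∑≡∑ n (λ i → ∑≡∑ n (λ j → ∑≡∑ n (λ l → refl)))

evalF≡eval : ∀ {n} (c : QuarticForm n) x → evalF c x ≡ eval 4 c x
evalF≡eval {n} c x = ∑≡∑ n (λ i → ∑≡∑ n (λ j → ∑≡∑ n (λ l → ∑≡∑ n (λ m → refl))))

lincomb≡lincomb : ∀ {n k} (S : Fin k → Vec₂ n) x i → lincomb S x i ≡ ℚ₂Forms.lincomb S x i
lincomb≡lincomb {k = k} S x i = ∑≡∑ k (λ j → refl)

#monomials₂*2 : ∀ k → k * (k + 1) ≡ #monomials₂ k * 2
#monomials₂*2 zero    = refl
#monomials₂*2 (suc k) = trans (step k) (trans (cong (λ z → z + (k + 1) * 2) (#monomials₂*2 k)) (collect (#monomials₂ k) k))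
  where step : ∀ k → suc k * (suc k + 1) ≡ k * (k + 1) + (k + 1) * 2
        step = solve-∀
        collect : ∀ a k → a * 2 + (k + 1) * 2 ≡ (a + (k + 1)) * 2
        collect = solve-∀

#monomials₃*6 : ∀ k → k * (k + 1) * (k + 2) ≡ #monomials₃ k * 6
#monomials₃*6 zero    = refl
#monomials₃*6 (suc k) =
  trans (step k) (trans (cong₂ (λ z w → z + w * 3 + (k + 1) * 6) (#monomials₃*6 k) (#monomials₂*2 k))
                        (collect (#monomials₃ k) (#monomials₂ k) k))
  where step : ∀ k → suc k * (suc k + 1) * (suc k + 2) ≡ k * (k + 1) * (k + 2) + k * (k + 1) * 3 + (k + 1) * 6
        step = solve-∀
        collect : ∀ a b k → a * 6 + b * 2 * 3 + (k + 1) * 6 ≡ (a + (b + (k + 1))) * 6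
        collect = solve-∀

#monomials₂≡ : ∀ k → (k * (k + 1)) / 2 ≡ #monomials₂ k
#monomials₂≡ k = trans (cong (_/ 2) (#monomials₂*2 k)) (m*n/n≡m (#monomials₂ k) 2)

#monomials₃≡ : ∀ k → (k * (k + 1) * (k + 2)) / 6 ≡ #monomials₃ k
#monomials₃≡ k = trans (cong (_/ 6) (#monomials₃*6 k)) (m*n/n≡m (#monomials₃ k) 6)

≈-stable : ∀ (a b : ℚ₂) → ¬ ¬ (a ≈ b) → a ≈ b
≈-stable a b ¬¬a≈b i with shift (den b) (num a) i ≟ᵇ shift (den a) (num b) i
... | yes eq = eq
... | no neq = ⊥-elim (¬¬a≈b (λ a≈b → neq (a≈b i)))

orthogonalitySystem : ∀ {n k} → QuarticForm n → (Fin k → Vec₂ n) → System k (#monomials₂ k) (#monomials₃ k) n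
orthogonalitySystem F S = record
  { cubics = cubicConditions F S ; quadratics = quadraticConditions F S ; linears = linearConditions F S }

evalF≃eval : ∀ {n} (F : QuarticForm n) {y y'} → (∀ i → y i ≡ y' i) → evalF F y ≃ eval 4 F y'
evalF≃eval F {y} y≡y' = ≃-trans (≃-reflexive (evalF≡eval F y)) (eval-congʳ 4 F (λ i → ≃-reflexive (y≡y' i)))

commonZero⇒orthogonal : ∀ {n k} (F : QuarticForm n) (S : Fin k → Vec₂ n) e → CommonZero (orthogonalitySystem F S) e →
  (x : Fin k → ℚ₂) (t : ℚ₂) →
  evalF F (lincomb S x +ᵛ (t ·ᵛ e)) ≈ evalF F (lincomb S x) Defs.+ evalF F e Defs.* (t ^4)
commonZero⇒orthogonal F S e (cubic≈0 , quadratic≈0 , linear≈0) x t = ≃⇒≈ (begin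
    evalF F (lincomb S x +ᵛ (t ·ᵛ e))
      ≈⟨ evalF≃eval F (λ i → cong (Defs._+ t Defs.* e i) (lincomb≡lincomb S x i)) ⟩
    eval 4 F (λ i → ℚ₂Forms.lincomb S x i Defs.+ t Defs.* e i)
      ≈⟨ orthogonal F S e (λ a → subst (_≃ 0q) (evalC≡eval _ e) (mk≃ (cubic≈0 a)))
                          (λ ι → subst (_≃ 0q) (evalQ≡eval _ e) (mk≃ (quadratic≈0 ι)))
                          (λ ι → subst (_≃ 0q) (evalL≡eval _ e) (mk≃ (linear≈0 ι))) x t ⟩
    eval 4 F (ℚ₂Forms.lincomb S x) Defs.+ eval 4 F e Defs.* (t ^4)
      ≈⟨ +-cong (evalF≃eval F (lincomb≡lincomb S x)) (*-cong (evalF≃eval F (λ _ → refl)) ≃-refl) ⟨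
    evalF F (lincomb S x) Defs.+ evalF F e Defs.* (t ^4)
      ∎)

noOrthogonal⇒onlyTrivialCommonZero : ∀ {n k} (F : QuarticForm n) (S : Fin k → Vec₂ n) →
                                     ¬ Σ (Vec₂ n) (Orthogonal F S) → OnlyTrivialCommonZero (orthogonalitySystem F S)
noOrthogonal⇒onlyTrivialCommonZero F S none e common i =
  ≈-stable (e i) 0q (λ eᵢ≉0 → none (e , (λ e≈0 → eᵢ≉0 (e≈0 i)) , commonZero⇒orthogonal F S e common))

¬¬orthogonal : ∀ n k (F : QuarticForm n) (S : Fin k → Vec₂ n) →
               Σ ℕ (λ v → IsV₃ k (#monomials₂ k) (#monomials₃ k) v × v < n) → ¬ ¬ Σ (Vec₂ n) (Orthogonal F S)
¬¬orthogonal n k F S (v , (_ , maximal) , v<n) none =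
  ≤⇒≯ (maximal n (orthogonalitySystem F S , noOrthogonal⇒onlyTrivialCommonZero F S none)) v<n

lemma14 : (n k : ℕ) (F : QuarticForm n) → OnlyTrivialZero F →
    (S : Fin k → Vec₂ n) → (∀ i → NonZeroVec (S i)) →
    (∀ i j → ¬ i ≡ j → ¬ (∀ t → S i t ≈ S j t)) →
    Σ ℕ (λ v → IsV₃ k ((k * (k + 1)) / 2) ((k * (k + 1) * (k + 2)) / 6) v × v < n) →
    ¬ ¬ Σ (Vec₂ n) (λ e → Orthogonal F S e)
lemma14 n k F _ S _ _ n>V₃ =
  ¬¬orthogonal n k F S (subst₂ (λ b c → Σ ℕ (λ v → IsV₃ k b c v × v < n)) (#monomials₂≡ k) (#monomials₃≡ k) n>V₃)
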